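{- For every $X\subseteq\omega$ there is an $X$-computable embedding $F:\mathcal{K}_1^X\to\mathcal{K}_2$ such that for all ordinals $\alpha$ and all closed terms $s,t$ over $\mathcal{K}_1^X$, $s\sim_\alpha t$ in $\mathcal{K}_1^X$ if and only if $F(s)\sim_\alpha F(t)$ in $\mathcal{K}_2$. The analogous statement with $\mathcal{K}_1$ in place of $\mathcal{K}_1^X$ (and a computable embedding) holds as well.
   Context: For $X\subseteq\omega$, $\mathcal{K}_1^X$ is the pca on $\omega$ with $n\cdot m=\Phi_n^X(m)$; $\mathcal{K}_1$ is the pca on $\omega$ with $n\cdot m=\Phi_n(m)$. Kleene's second model $\mathcal{K}_2$ is the pca on $\omega^\omega$ with $f\cdot g$ the result of applying the partial continuous functional coded by $f$ (Kleene's standard coding) to $g$. For pca's $\mathcal{A},\mathcal{B}$, an embedding is an injective map $F:\mathcal{A}\to\mathcal{B}$ such that for all $a,b,c$: if $a\cdot_\mathcal{A}b$ is defined and equals $c$ then $F(a)\cdot_\mathcal{B}F(b)$ is defined and equals $F(c)$; if $a\cdot_\mathcal{A}b$ is undefined then so is $F(a)\cdot_\mathcal{B}F(b)$. $F$ is extended to closed terms by $F(st)=F(s)F(t)$. $F$ being $X$-computable means the sequence $(F(n))_{n\in\omega}$ of elements of $\omega^\omega$ is uniformly $X$-computable. Closed terms are built from elements by application (associating to the left); $s\simeq t$ means both undefined or both defined and equal. Relations $\sim_\alpha$: $s\sim_0 t$ iff $s\simeq t$; $s \sim_{\alpha+1} t$ iff $sx \sim_\alpha tx$ for all $x$ in the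 pca; for limit $\alpha$, $s\sim_\alpha t$ iff $s\sim_\beta t$ for some $\beta<\alpha$. -}

module Defs where

open import Data.Nat using (ℕ; zero; suc; _+_; _<_)
open import Data.Bool using (Bool; true; false; if_then_else_)
open import Data.Product using (Σ; _×_; _,_; proj₁; proj₂)
open import Data.List using (List; []; _∷_; map; upTo)
open import Data.Empty using (⊥)
open import Relation.Nullary using (¬_)
open import Relation.Binary.PropositionalEquality using (_≡_)

tri : ℕ → ℕ
tri zero    = zero
tri (suc d) = tri d + suc d

pair : ℕ → ℕ → ℕ
pair a b = tri (a + b) + b

-- inverse of pair, enumerating the diagonals
unpair : ℕ → ℕ × ℕ
unpair zero = (0 , 0)
unpair (suc n) with unpair n
... | (zero , b)  = (suc b , 0)
... | (suc a , b) = (a , suc b)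

fst snd : ℕ → ℕ
fst n = proj₁ (unpair n)
snd n = proj₂ (unpair n)

seqCode : List ℕ → ℕ
seqCode []       = 0
seqCode (x ∷ xs) = suc (pair x (seqCode xs))

Oracle : Set
Oracle = ℕ → Bool

-- Programs for unary partial X-recursive functions (on ℕ, using pairing)

data Code : Set where
  zer succ ident fstC sndC orc : Code
  prC   : Code → Code → Code
  comp  : Code → Code → Code   -- comp f g = f ∘ g
  rec   : Code → Code → Code   -- primitive recursion on ⟨x , n⟩
  mu    : Code → Code          -- x ↦ least y with f⟨x,y⟩ = 0

mutual
  data Ev (X : Oracle) : Code → ℕ → ℕ → Set where
    ev-zer   : ∀ x → Ev X zer x 0
    ev-succ  : ∀ x → Ev X succ x (suc x)
    ev-ident : ∀ x → Ev X ident x x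
    ev-fst   : ∀ x → Ev X fstC x (fst x)
    ev-snd   : ∀ x → Ev X sndC x (snd x)
    ev-orc   : ∀ x → Ev X orc x (if X x then 1 else 0)
    ev-pr    : ∀ {f g x a b} → Ev X f x a → Ev X g x b → Ev X (prC f g) x (pair a b)
    ev-comp  : ∀ {f g x y z} → Ev X g x y → Ev X f y z → Ev X (comp f g) x z
    ev-rec   : ∀ {f g z y} → Rec X f g (fst z) (snd z) y → Ev X (rec f g) z y
    ev-mu    : ∀ {f x y} → Ev X f (pair x y) 0 →
               (∀ z → z < y → Σ ℕ (λ w → Ev X f (pair x z) (suc w))) →
               Ev X (mu f) x y

  data Rec (X : Oracle) (f g : Code) (x : ℕ) : ℕ → ℕ → Set where
    rec-0 : ∀ {y} → Ev X f x y → Rec X f g x 0 y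
    rec-S : ∀ {n y z} → Rec X f g x n y → Ev X g (pair (pair x n) y) z →
            Rec X f g x (suc n) z

-- Gödel numbering ℕ → Code (fuel-bounded decoding; components are strictly
-- smaller than the number, so fuel n suffices for n)
decode′ : ℕ → ℕ → Code
decode′ zero n = zer
decode′ (suc fuel) n with fst n
... | 0 = zer
... | 1 = succ
... | 2 = ident
... | 3 = fstC
... | 4 = sndC
... | 5 = orc
... | 6 = prC  (decode′ fuel (fst (snd n))) (decode′ fuel (snd (snd n)))
... | 7 = comp (decode′ fuel (fst (snd n))) (decode′ fuel (snd (snd n)))
... | 8 = rec  (decode′ fuel (fst (snd n))) (decode′ fuel (snd (snd n)))
... | 9 = mu   (decode′ fuel (snd n))
... | _ = zer

decode : ℕ → Code
decode n = decode′ n n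

Φ : Oracle → ℕ → ℕ → ℕ → Set
Φ X n m y = Ev X (decode n) m y

record PAS : Set₁ where
  field
    Carrier : Set
    _≈_     : Carrier → Carrier → Set
    App     : Carrier → Carrier → Carrier → Set

K1X : Oracle → PAS
K1X X = record { Carrier = ℕ ; _≈_ = _≡_ ; App = Φ X }

emptyOracle : Oracle
emptyOracle _ = false

K1 : PAS
K1 = K1X emptyOracle

Baire : Set
Baire = ℕ → ℕ

query : ℕ → Baire → ℕ → ℕ
query n g k = seqCode (n ∷ map g (upTo k))

App2 : Baire → Baire → Baire → Set
App2 f g h = ∀ n → Σ ℕ λ k →
               (∀ j → j < k → f (query n g j) ≡ 0) ×
               (f (query n g k) ≡ suc (h n))

K2 : PAS
K2 = record { Carrier = Baire ; _≈_ = λ f g → ∀ n → f n ≡ g n ; App = App2 }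

data Term (A : Set) : Set where
  el  : A → Term A
  _·_ : Term A → Term A → Term A

infixl 7 _·_

mapTerm : {A B : Set} → (A → B) → Term A → Term B
mapTerm F (el a)  = el (F a)
mapTerm F (s · t) = mapTerm F s · mapTerm F t

module _ (𝒜 : PAS) where
  open PAS 𝒜

  Eval : Term Carrier → Carrier → Set
  Eval (el a)  c = a ≈ c
  Eval (s · t) c = Σ Carrier λ a → Σ Carrier λ b → Eval s a × Eval t b × App a b c

  Defined : Term Carrier → Set
  Defined s = Σ Carrier (Eval s)

  KEq : Term Carrier → Term Carrier → Set
  KEq s t = (Defined s → Defined t) × (Defined t → Defined s) ×
            (∀ c d → Eval s c → Eval t d → c ≈ d)

-- Ordinals (generalised Brouwer ordinals: limits of nonempty families
-- indexed by arbitrary small types)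

data Ord : Set₁ where
  ozero : Ord
  osuc  : Ord → Ord
  olim  : {I : Set} → I → (I → Ord) → Ord

module _ (𝒜 : PAS) where
  open PAS 𝒜

  Sim : Ord → Term Carrier → Term Carrier → Set
  Sim ozero      s t = KEq 𝒜 s t
  Sim (osuc α)   s t = ∀ x → Sim α (s · el x) (t · el x)
  Sim (olim {I} _ f) s t = Σ I λ i → Sim (f i) s t

record IsEmbedding (𝒜 ℬ : PAS) (F : PAS.Carrier 𝒜 → PAS.Carrier ℬ) : Set where
  module A = PAS 𝒜
  module B = PAS ℬ
  field
    injective : ∀ a b → F a B.≈ F b → a A.≈ b
    pres-def  : ∀ a b c → A.App a b c → B.App (F a) (F b) (F c)
    pres-undef : ∀ a b → ¬ (Σ A.Carrier (A.App a b)) → ¬ (Σ B.Carrier (B.App (F a) (F b)))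

XComputable : Oracle → (ℕ → Baire) → Set
XComputable X F = Σ Code λ e → ∀ n k → Ev X e (pair n k) (F n k)

_⇔_ : Set → Set → Set
P ⇔ Q = (P → Q) × (Q → P)

GoodEmbedding : Oracle → Set₁
GoodEmbedding X =
  Σ (ℕ → Baire) λ F →
    IsEmbedding (K1X X) K2 F ×
    XComputable X F ×
    (∀ (α : Ord) (s t : Term ℕ) →
       Sim (K1X X) α s t ⇔ Sim K2 α (mapTerm F s) (mapTerm F t))

module Submission where

-- The embedding sends a to the neighbourhood function embed a of a K₂-element with
-- embed a · g = embed (Φ_a^X(g 0)), defined exactly when Φ_a^X(g 0) is, and with
-- embed a 0 = a.  So embed is an embedding, and since embed(s) · g only looks at g 0,
-- the quantifier over all of Baire space in ∼_{α+1} ranges, in effect, over the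
-- image of embed; induction on α transfers ∼_α in both directions.
--
-- X-computability is the delicate part: Φ comes with no step counter, so embed a
-- answers a query only after finding, among the numbers below the query's code, the
-- code of a derivation of Φ_a^X(g 0) = y.  Derivations are checked primitive
-- recursively in X, and every convergent computation has one, so the answer appears
-- eventually exactly when Φ_a^X(g 0) converges.

open import Data.Bool using (if_then_else_)
open import Data.Empty using (⊥; ⊥-elim)
open import Data.List using (List; []; _∷_; _++_; length; map; upTo; applyUpTo)
open import Data.List.Properties using (length-applyUpTo; length-map; map-cong)
open import Data.List.Relation.Unary.All using (All; []; _∷_; lookupAny)
open import Data.List.Relation.Unary.Any using (Any; here; there)
open import Data.List.Relation.Unary.Any.Properties using (++⁺ˡ; ++⁺ʳ)
open import Data.Nat using (ℕ; zero; suc; pred; _+_; _∸_; _≤_; _<_; z≤n; s≤s)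
open import Data.Nat.Properties
open import Data.Product using (Σ-syntax; _×_; _,_; proj₁; proj₂)
open import Data.Sum using (_⊎_; inj₁; inj₂)
open import Data.Unit using (⊤; tt)
open import Relation.Binary.Definitions using (tri<; tri≈; tri>)
open import Relation.Binary.PropositionalEquality

open import Defs

pair-suc : ∀ a b → pair a (suc b) ≡ suc (pair (suc a) b)
pair-suc a b rewrite +-suc a b | +-suc (tri (suc (a + b))) b = refl

pair-suc-zero : ∀ d → pair (suc d) 0 ≡ suc (pair 0 d)
pair-suc-zero d rewrite +-identityʳ d | +-identityʳ (tri d + suc d) = +-suc (tri d) d

unpair-pair : ∀ a b → unpair (pair a b) ≡ (a , b)
unpair-pair a b = on-diagonal (a + b) a b refl
  where
  on-diagonal : ∀ s a b → a + b ≡ s → unpair (pair a b) ≡ (a , b)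
  on-diagonal s zero zero e = refl
  on-diagonal s a (suc b) e
    rewrite pair-suc a b | on-diagonal s (suc a) b (trans (sym (+-suc a b)) e) = refl
  on-diagonal (suc s) (suc d) zero e
    rewrite pair-suc-zero d | on-diagonal s zero d (trans (sym (+-identityʳ d)) (suc-injective e)) = refl

fst-pair : ∀ a b → fst (pair a b) ≡ a
fst-pair a b = cong proj₁ (unpair-pair a b)

snd-pair : ∀ a b → snd (pair a b) ≡ b
snd-pair a b = cong proj₂ (unpair-pair a b)

pair-unpair : ∀ n → pair (fst n) (snd n) ≡ n
pair-unpair zero = refl
pair-unpair (suc n) with unpair n | pair-unpair n
... | zero  , b | e = trans (pair-suc-zero b) (cong suc e)
... | suc a , b | e = trans (pair-suc a b) (cong suc e)

n≤tri[n] : ∀ n → n ≤ tri n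
n≤tri[n] zero    = z≤n
n≤tri[n] (suc n) = m≤n+m (suc n) (tri n)

a≤pair[a,b] : ∀ a b → a ≤ pair a b
a≤pair[a,b] a b = ≤-trans (m≤m+n a b) (≤-trans (n≤tri[n] (a + b)) (m≤m+n _ b))

b≤pair[a,b] : ∀ a b → b ≤ pair a b
b≤pair[a,b] a b = m≤n+m b (tri (a + b))

fst[n]≤n : ∀ n → fst n ≤ n
fst[n]≤n n = subst (fst n ≤_) (pair-unpair n) (a≤pair[a,b] (fst n) (snd n))

snd[n]≤n : ∀ n → snd n ≤ n
snd[n]≤n n = subst (snd n ≤_) (pair-unpair n) (b≤pair[a,b] (fst n) (snd n))

snd[n]<n : ∀ n {k} → fst n ≡ suc k → snd n < n
snd[n]<n n {k} e = subst (snd n <_) (trans (cong (λ a → pair a (snd n)) (sym e)) (pair-unpair n))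
                     (+-monoˡ-≤ (snd n) {1} (≤-trans (s≤s z≤n) (n≤tri[n] (suc k + snd n))))

fst[snd[n]]<n : ∀ n {k} → fst n ≡ suc k → fst (snd n) < n
fst[snd[n]]<n n e = ≤-<-trans (fst[n]≤n (snd n)) (snd[n]<n n e)

snd[snd[n]]<n : ∀ n {k} → fst n ≡ suc k → snd (snd n) < n
snd[snd[n]]<n n e = ≤-<-trans (snd[n]≤n (snd n)) (snd[n]<n n e)

seqCode-surjective : ∀ n → Σ[ L ∈ List ℕ ] seqCode L ≡ n
seqCode-surjective n = bounded n n ≤-refl
  where
  bounded : ∀ fuel n → n ≤ fuel → Σ[ L ∈ List ℕ ] seqCode L ≡ n
  bounded fuel       zero    _  = [] , refl
  bounded (suc fuel) (suc m) m<1+fuel with bounded fuel (snd m) (≤-trans (snd[n]≤n m) (≤-pred m<1+fuel))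
  ... | L , e = fst m ∷ L , cong suc (trans (cong (pair (fst m)) e) (pair-unpair m))

length≤seqCode : ∀ L → length L ≤ seqCode L
length≤seqCode []      = z≤n
length≤seqCode (e ∷ L) = s≤s (≤-trans (length≤seqCode L) (b≤pair[a,b] e (seqCode L)))

decodeStep : ℕ → (ℕ → Code) → ℕ → Code
decodeStep 0 d n = zer
decodeStep 1 d n = succ
decodeStep 2 d n = ident
decodeStep 3 d n = fstC
decodeStep 4 d n = sndC
decodeStep 5 d n = orc
decodeStep 6 d n = prC  (d (fst (snd n))) (d (snd (snd n)))
decodeStep 7 d n = comp (d (fst (snd n))) (d (snd (snd n)))
decodeStep 8 d n = rec  (d (fst (snd n))) (d (snd (snd n)))
decodeStep 9 d n = mu   (d (snd n))
decodeStep (suc (suc (suc (suc (suc (suc (suc (suc (suc (suc _)))))))))) d n = zer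

decode′-suc : ∀ fuel n → decode′ (suc fuel) n ≡ decodeStep (fst n) (decode′ fuel) n
decode′-suc fuel n with fst n
... | 0 = refl
... | 1 = refl
... | 2 = refl
... | 3 = refl
... | 4 = refl
... | 5 = refl
... | 6 = refl
... | 7 = refl
... | 8 = refl
... | 9 = refl
... | suc (suc (suc (suc (suc (suc (suc (suc (suc (suc _))))))))) = refl

decodeStep-cong : ∀ k n {d d′ : ℕ → Code} → fst n ≡ k →
                  (∀ m → m < n → d m ≡ d′ m) → decodeStep k d n ≡ decodeStep k d′ n
decodeStep-cong 0 n _ _ = refl
decodeStep-cong 1 n _ _ = refl
decodeStep-cong 2 n _ _ = refl
decodeStep-cong 3 n _ _ = refl
decodeStep-cong 4 n _ _ = refl
decodeStep-cong 5 n _ _ = refl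
decodeStep-cong 6 n e d≗d′ = cong₂ prC  (d≗d′ _ (fst[snd[n]]<n n e)) (d≗d′ _ (snd[snd[n]]<n n e))
decodeStep-cong 7 n e d≗d′ = cong₂ comp (d≗d′ _ (fst[snd[n]]<n n e)) (d≗d′ _ (snd[snd[n]]<n n e))
decodeStep-cong 8 n e d≗d′ = cong₂ rec  (d≗d′ _ (fst[snd[n]]<n n e)) (d≗d′ _ (snd[snd[n]]<n n e))
decodeStep-cong 9 n e d≗d′ = cong mu (d≗d′ _ (snd[n]<n n e))
decodeStep-cong (suc (suc (suc (suc (suc (suc (suc (suc (suc (suc _)))))))))) n _ _ = refl

decode′-fuel-irrelevant : ∀ f f′ n → n ≤ f → n ≤ f′ → decode′ f n ≡ decode′ f′ n
decode′-fuel-irrelevant zero    zero     n       _ _ = refl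
decode′-fuel-irrelevant zero    (suc f′) zero    _ _ = sym (decode′-suc f′ 0)
decode′-fuel-irrelevant (suc f) zero     zero    _ _ = decode′-suc f 0
decode′-fuel-irrelevant (suc f) (suc f′) n n≤f n≤f′ = begin
  decode′ (suc f) n                  ≡⟨ decode′-suc f n ⟩
  decodeStep (fst n) (decode′ f) n   ≡⟨ decodeStep-cong (fst n) n refl (λ m m<n →
                                          decode′-fuel-irrelevant f f′ m (≤-pred (≤-trans m<n n≤f))
                                                                         (≤-pred (≤-trans m<n n≤f′))) ⟩
  decodeStep (fst n) (decode′ f′) n  ≡⟨ sym (decode′-suc f′ n) ⟩
  decode′ (suc f′) n                 ∎
  where open ≡-Reasoning

decode-unfold : ∀ n → decode n ≡ decodeStep (fst n) decode n
decode-unfold zero    = refl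
decode-unfold (suc n) = trans (decode′-suc n (suc n)) (decodeStep-cong (fst (suc n)) (suc n) refl
  (λ m m<n → decode′-fuel-irrelevant n m m (≤-pred m<n) ≤-refl))

data CodeView (n : ℕ) : Code → Set where
  zer-view   : fst n ≡ 0 ⊎ Σ[ m ∈ ℕ ] fst n ≡ 10 + m → CodeView n zer
  succ-view  : fst n ≡ 1 → CodeView n succ
  ident-view : fst n ≡ 2 → CodeView n ident
  fst-view   : fst n ≡ 3 → CodeView n fstC
  snd-view   : fst n ≡ 4 → CodeView n sndC
  orc-view   : fst n ≡ 5 → CodeView n orc
  pr-view    : fst n ≡ 6 → CodeView n (prC  (decode (fst (snd n))) (decode (snd (snd n))))
  comp-view  : fst n ≡ 7 → CodeView n (comp (decode (fst (snd n))) (decode (snd (snd n))))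
  rec-view   : fst n ≡ 8 → CodeView n (rec  (decode (fst (snd n))) (decode (snd (snd n))))
  mu-view    : fst n ≡ 9 → CodeView n (mu (decode (snd n)))

codeView : ∀ n → CodeView n (decode n)
codeView n = subst (CodeView n) (sym (decode-unfold n)) (view (fst n) refl)
  where
  view : ∀ k → fst n ≡ k → CodeView n (decodeStep k decode n)
  view 0 e = zer-view (inj₁ e)
  view 1 e = succ-view e
  view 2 e = ident-view e
  view 3 e = fst-view e
  view 4 e = snd-view e
  view 5 e = orc-view e
  view 6 e = pr-view e
  view 7 e = comp-view e
  view 8 e = rec-view e
  view 9 e = mu-view e
  view (suc (suc (suc (suc (suc (suc (suc (suc (suc (suc m)))))))))) e = zer-view (inj₂ (m , e))

module _ {X : Oracle} where
  mutual
    Ev-deterministic : ∀ {c x y y′} → Ev X c x y → Ev X c x y′ → y ≡ y′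
    Ev-deterministic (ev-zer _)   (ev-zer _)   = refl
    Ev-deterministic (ev-succ _)  (ev-succ _)  = refl
    Ev-deterministic (ev-ident _) (ev-ident _) = refl
    Ev-deterministic (ev-fst _)   (ev-fst _)   = refl
    Ev-deterministic (ev-snd _)   (ev-snd _)   = refl
    Ev-deterministic (ev-orc _)   (ev-orc _)   = refl
    Ev-deterministic (ev-pr d₁ d₂) (ev-pr e₁ e₂) = cong₂ pair (Ev-deterministic d₁ e₁) (Ev-deterministic d₂ e₂)
    Ev-deterministic (ev-comp d₁ d₂) (ev-comp e₁ e₂) with Ev-deterministic d₁ e₁
    ... | refl = Ev-deterministic d₂ e₂
    Ev-deterministic (ev-rec r) (ev-rec r′) = Rec-deterministic r r′
    Ev-deterministic {y = y} {y′} (ev-mu d₀ below) (ev-mu e₀ below′) with <-cmp y y′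
    ... | tri≈ _ y≡y′ _ = y≡y′
    ... | tri< y<y′ _ _ = ⊥-elim (0≢1+n (Ev-deterministic d₀ (proj₂ (below′ y y<y′))))
    ... | tri> _ _ y′<y = ⊥-elim (0≢1+n (Ev-deterministic e₀ (proj₂ (below y′ y′<y))))

    Rec-deterministic : ∀ {f g x n y y′} → Rec X f g x n y → Rec X f g x n y′ → y ≡ y′
    Rec-deterministic (rec-0 d) (rec-0 e) = Ev-deterministic d e
    Rec-deterministic (rec-S r d) (rec-S r′ e) with Rec-deterministic r r′
    ... | refl = Ev-deterministic d e

-- Predicates are represented by ℕ-valued functions, 0 meaning true.

ifz : ℕ → ℕ → ℕ → ℕ
ifz zero    a b = a
ifz (suc _) a b = b

eqN : ℕ → ℕ → ℕ
eqN a b = ifz (a ∸ b) (b ∸ a) 1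

andN : ℕ → ℕ → ℕ
andN a b = ifz a b 1

eqN-sound : ∀ a b → eqN a b ≡ 0 → a ≡ b
eqN-sound a b h with a ∸ b in a∸b≡0
... | zero with b ∸ a in b∸a≡0
...   | zero = ≤-antisym (m∸n≡0⇒m≤n a∸b≡0) (m∸n≡0⇒m≤n b∸a≡0)

eqN-refl : ∀ a → eqN a a ≡ 0
eqN-refl a rewrite n∸n≡0 a = refl

eqN-complete : ∀ {a b} → a ≡ b → eqN a b ≡ 0
eqN-complete {a} refl = eqN-refl a

andN-sound : ∀ a b → andN a b ≡ 0 → a ≡ 0 × b ≡ 0
andN-sound zero b h = refl , h

primRec : (ℕ → ℕ) → (ℕ → ℕ) → ℕ → ℕ → ℕ
primRec f g x zero    = f x
primRec f g x (suc n) = g (pair (pair x n) (primRec f g x n))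

select : (ℕ → ℕ) → List (ℕ → ℕ) → ℕ → ℕ → ℕ
select d []       k       x = d x
select d (f ∷ fs) zero    x = f x
select d (f ∷ fs) (suc k) x = select d fs k x

loop : (stop out next base : ℕ → ℕ) → ℕ → ℕ → ℕ
loop stop out next base zero       x = base x
loop stop out next base (suc fuel) x = ifz (stop x) (out x) (loop stop out next base fuel (next x))

-- A loop is simulated by iterating a single step on states pair 0 x (running, at x)
-- and pair 1 v (halted with output v).
module LoopSimulation (stop out next base : ℕ → ℕ) where

  step : ℕ → ℕ
  step st = ifz (fst st) (ifz (stop (snd st)) (pair 1 (out (snd st))) (pair 0 (next (snd st)))) st

  finish : ℕ → ℕ
  finish st = ifz (fst st) (base (snd st)) (snd st)

  iterate : ℕ → ℕ → ℕ
  iterate st zero    = st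
  iterate st (suc k) = step (iterate st k)

  iterate-suc : ∀ k st → iterate st (suc k) ≡ iterate (step st) k
  iterate-suc zero    st = refl
  iterate-suc (suc k) st = cong step (iterate-suc k st)

  iterate-halted : ∀ k v → iterate (pair 1 v) k ≡ pair 1 v
  iterate-halted zero    v = refl
  iterate-halted (suc k) v rewrite iterate-halted k v | fst-pair 1 v = refl

  finish-iterate : ∀ fuel x → finish (iterate (pair 0 x) fuel) ≡ loop stop out next base fuel x
  finish-iterate zero x rewrite fst-pair 0 x | snd-pair 0 x = refl
  finish-iterate (suc fuel) x rewrite iterate-suc fuel (pair 0 x) | fst-pair 0 x | snd-pair 0 x with stop x
  ... | zero  rewrite iterate-halted fuel (out x) | fst-pair 1 (out x) | snd-pair 1 (out x) = refl
  ... | suc _ = finish-iterate fuel (next x)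

  primRec-iterate : ∀ x k → primRec (pair 0) (λ q → step (snd q)) x k ≡ iterate (pair 0 x) k
  primRec-iterate x zero    = refl
  primRec-iterate x (suc k) rewrite snd-pair (pair x k) (primRec (pair 0) (λ q → step (snd q)) x k) =
    cong step (primRec-iterate x k)

module Computable (X : Oracle) where

  Computable : (ℕ → ℕ) → Set
  Computable f = Σ[ c ∈ Code ] ∀ x → Ev X c x (f x)

  Computable₂ : (ℕ → ℕ → ℕ) → Set
  Computable₂ f = Computable (λ q → f (fst q) (snd q))

  computable-ext : ∀ {f g} → Computable f → (∀ x → f x ≡ g x) → Computable g
  computable-ext (c , ev) f≗g = c , λ x → subst (Ev X c x) (f≗g x) (ev x)

  zeroᶜ : Computable (λ _ → 0)
  zeroᶜ = zer , ev-zer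

  sucᶜ : Computable suc
  sucᶜ = succ , ev-succ

  idᶜ : Computable (λ x → x)
  idᶜ = ident , ev-ident

  fstᶜ : Computable fst
  fstᶜ = fstC , ev-fst

  sndᶜ : Computable snd
  sndᶜ = sndC , ev-snd

  oracleᶜ : Computable (λ x → if X x then 1 else 0)
  oracleᶜ = orc , ev-orc

  infixr 9 _∘ᶜ_
  _∘ᶜ_ : ∀ {f g} → Computable f → Computable g → Computable (λ x → f (g x))
  (cf , evf) ∘ᶜ (cg , evg) = comp cf cg , λ x → ev-comp (evg x) (evf _)

  ⟨_,_⟩ᶜ : ∀ {f g} → Computable f → Computable g → Computable (λ x → pair (f x) (g x))
  ⟨ (cf , evf) , (cg , evg) ⟩ᶜ = prC cf cg , λ x → ev-pr (evf x) (evg x)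

  primRecᶜ : ∀ {f g} → Computable f → Computable g → Computable₂ (primRec f g)
  primRecᶜ {f} {g} (cf , evf) (cg , evg) = rec cf cg , λ z → ev-rec (unfold (fst z) (snd z))
    where
    unfold : ∀ x n → Rec X cf cg x n (primRec f g x n)
    unfold x zero    = rec-0 (evf x)
    unfold x (suc n) = rec-S (unfold x n) (evg _)

  constᶜ : ∀ k → Computable (λ _ → k)
  constᶜ zero    = zeroᶜ
  constᶜ (suc k) = sucᶜ ∘ᶜ constᶜ k

  apply₂ᶜ : ∀ f {a b} → Computable₂ f → Computable a → Computable b → Computable (λ x → f (a x) (b x))
  apply₂ᶜ f {a} {b} fᶜ aᶜ bᶜ = computable-ext (fᶜ ∘ᶜ ⟨ aᶜ , bᶜ ⟩ᶜ)
    λ x → cong₂ f (fst-pair (a x) (b x)) (snd-pair (a x) (b x))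

  ifzᶜ : ∀ {p a b} → Computable p → Computable a → Computable b → Computable (λ x → ifz (p x) (a x) (b x))
  ifzᶜ {p} {a} {b} pᶜ aᶜ bᶜ =
    computable-ext (primRecᶜ aᶜ (bᶜ ∘ᶜ fstᶜ ∘ᶜ fstᶜ) ∘ᶜ ⟨ idᶜ , pᶜ ⟩ᶜ) cases
    where
    cases : ∀ x → primRec a (λ q → b (fst (fst q))) (fst (pair x (p x))) (snd (pair x (p x))) ≡ ifz (p x) (a x) (b x)
    cases x rewrite fst-pair x (p x) | snd-pair x (p x) with p x
    ... | zero  = refl
    ... | suc n rewrite fst-pair (pair x n) (primRec a (λ q → b (fst (fst q))) x n) | fst-pair x n = refl

  predᶜ : Computable pred
  predᶜ = computable-ext (primRecᶜ zeroᶜ (sndᶜ ∘ᶜ fstᶜ) ∘ᶜ ⟨ idᶜ , idᶜ ⟩ᶜ) cases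
    where
    cases : ∀ x → primRec (λ _ → 0) (λ q → snd (fst q)) (fst (pair x x)) (snd (pair x x)) ≡ pred x
    cases x rewrite fst-pair x x | snd-pair x x with x
    ... | zero  = refl
    ... | suc n rewrite fst-pair (pair (suc n) n) (primRec (λ _ → 0) (λ q → snd (fst q)) (suc n) n)
                      | snd-pair (suc n) n = refl

  monusᶜ : Computable₂ _∸_
  monusᶜ = computable-ext (primRecᶜ idᶜ (predᶜ ∘ᶜ sndᶜ)) λ q → unfold (fst q) (snd q)
    where
    unfold : ∀ a n → primRec (λ x → x) (λ q → pred (snd q)) a n ≡ a ∸ n
    unfold a zero    = refl
    unfold a (suc n) rewrite snd-pair (pair a n) (primRec (λ x → x) (λ q → pred (snd q)) a n) | unfold a n =
      pred[m∸n]≡m∸[1+n] a n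

  addᶜ : Computable₂ _+_
  addᶜ = computable-ext (primRecᶜ idᶜ (sucᶜ ∘ᶜ sndᶜ)) λ q → unfold (fst q) (snd q)
    where
    unfold : ∀ a n → primRec (λ x → x) (λ q → suc (snd q)) a n ≡ a + n
    unfold a zero    = sym (+-identityʳ a)
    unfold a (suc n) rewrite snd-pair (pair a n) (primRec (λ x → x) (λ q → suc (snd q)) a n) | unfold a n =
      sym (+-suc a n)

  eqNᶜ : ∀ {a b} → Computable a → Computable b → Computable (λ x → eqN (a x) (b x))
  eqNᶜ aᶜ bᶜ = ifzᶜ (apply₂ᶜ _∸_ monusᶜ aᶜ bᶜ) (apply₂ᶜ _∸_ monusᶜ bᶜ aᶜ) (constᶜ 1)

  andNᶜ : ∀ {a b} → Computable a → Computable b → Computable (λ x → andN (a x) (b x))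
  andNᶜ aᶜ bᶜ = ifzᶜ aᶜ bᶜ (constᶜ 1)

  selectᶜ : ∀ {d k} fs → Computable d → All Computable fs → Computable k → Computable (λ x → select d fs (k x) x)
  selectᶜ []       dᶜ []         kᶜ = dᶜ
  selectᶜ {d} {k} (f ∷ fs) dᶜ (fᶜ ∷ fsᶜ) kᶜ =
    computable-ext (ifzᶜ kᶜ fᶜ (selectᶜ fs dᶜ fsᶜ (predᶜ ∘ᶜ kᶜ))) cases
    where
    cases : ∀ x → ifz (k x) (f x) (select d fs (pred (k x)) x) ≡ select d (f ∷ fs) (k x) x
    cases x with k x
    ... | zero  = refl
    ... | suc _ = refl

  loopᶜ : ∀ {stop out next base} → Computable stop → Computable out → Computable next → Computable base →
          Computable₂ (loop stop out next base)
  loopᶜ {stop} {out} {next} {base} stopᶜ outᶜ nextᶜ baseᶜ =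
    computable-ext (finishᶜ ∘ᶜ primRecᶜ ⟨ constᶜ 0 , idᶜ ⟩ᶜ (stepᶜ ∘ᶜ sndᶜ) ∘ᶜ ⟨ sndᶜ , fstᶜ ⟩ᶜ) simulates
    where
    open LoopSimulation stop out next base
    stepᶜ : Computable step
    stepᶜ = ifzᶜ fstᶜ (ifzᶜ (stopᶜ ∘ᶜ sndᶜ) ⟨ constᶜ 1 , outᶜ ∘ᶜ sndᶜ ⟩ᶜ ⟨ constᶜ 0 , nextᶜ ∘ᶜ sndᶜ ⟩ᶜ)
                     idᶜ
    finishᶜ : Computable finish
    finishᶜ = ifzᶜ fstᶜ (baseᶜ ∘ᶜ sndᶜ) sndᶜ
    simulates : ∀ q → finish (primRec (pair 0) (λ q → step (snd q)) (fst (pair (snd q) (fst q))) (snd (pair (snd q) (fst q))))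
                      ≡ loop stop out next base (fst q) (snd q)
    simulates q rewrite fst-pair (snd q) (fst q) | snd-pair (snd q) (fst q) | primRec-iterate (snd q) (fst q) =
      finish-iterate (fst q) (snd q)

-- A derivation is a list of entries pair j w, each concluding the judgement j from
-- premises concluded further down the list (trueJ needs no entry); the witness w
-- supplies the intermediate value of a composition, a recursion step or a search step.
opaque
  evJ : ℕ → ℕ → ℕ → ℕ
  evJ c x y = pair 0 (pair c (pair x y))

  recJ : ℕ → ℕ → ℕ → ℕ → ℕ → ℕ
  recJ f g x n y = pair 1 (pair f (pair g (pair x (pair n y))))

  belowJ : ℕ → ℕ → ℕ → ℕ
  belowJ f x y = pair 2 (pair f (pair x y))

  trueJ : ℕ
  trueJ = pair 3 0

opaque
  unfolding evJ recJ belowJ trueJ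

  evJ-def : ∀ c x y → evJ c x y ≡ pair 0 (pair c (pair x y))
  evJ-def c x y = refl

  recJ-def : ∀ f g x n y → recJ f g x n y ≡ pair 1 (pair f (pair g (pair x (pair n y))))
  recJ-def f g x n y = refl

  belowJ-def : ∀ f x y → belowJ f x y ≡ pair 2 (pair f (pair x y))
  belowJ-def f x y = refl

  trueJ-def : trueJ ≡ pair 3 0
  trueJ-def = refl

judgement witness rule args : ℕ → ℕ
judgement e = fst e
witness   e = snd e
rule      e = fst (judgement e)
args      e = snd (judgement e)

evCode evIn evOut opcode sub₁ sub₂ subμ : ℕ → ℕ
evCode e = fst (args e)
evIn   e = fst (snd (args e))
evOut  e = snd (snd (args e))
opcode e = fst (evCode e)
sub₁   e = fst (snd (evCode e))
sub₂   e = snd (snd (evCode e))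
subμ   e = snd (evCode e)

recBase recStep recArg recCount recOut : ℕ → ℕ
recBase  e = fst (args e)
recStep  e = fst (snd (args e))
recArg   e = fst (snd (snd (args e)))
recCount e = fst (snd (snd (snd (args e))))
recOut   e = snd (snd (snd (snd (args e))))

belowCode belowArg belowBound : ℕ → ℕ
belowCode  e = fst (args e)
belowArg   e = fst (snd (args e))
belowBound e = snd (snd (args e))

evPremises₁ evPremises₂ : List (ℕ → ℕ)
evPremises₁ = (λ _ → trueJ) ∷ (λ _ → trueJ) ∷ (λ _ → trueJ) ∷ (λ _ → trueJ) ∷ (λ _ → trueJ) ∷ (λ _ → trueJ) ∷
              (λ e → evJ (sub₁ e) (evIn e) (fst (evOut e))) ∷
              (λ e → evJ (sub₂ e) (evIn e) (witness e)) ∷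
              (λ e → recJ (sub₁ e) (sub₂ e) (fst (evIn e)) (snd (evIn e)) (evOut e)) ∷
              (λ e → evJ (subμ e) (pair (evIn e) (evOut e)) 0) ∷ []
evPremises₂ = (λ _ → trueJ) ∷ (λ _ → trueJ) ∷ (λ _ → trueJ) ∷ (λ _ → trueJ) ∷ (λ _ → trueJ) ∷ (λ _ → trueJ) ∷
              (λ e → evJ (sub₂ e) (evIn e) (snd (evOut e))) ∷
              (λ e → evJ (sub₁ e) (witness e) (evOut e)) ∷
              (λ _ → trueJ) ∷
              (λ e → belowJ (subμ e) (evIn e) (evOut e)) ∷ []

evPremise₁ evPremise₂ recPremise₁ recPremise₂ belowPremise₁ belowPremise₂ : ℕ → ℕ
evPremise₁ e = select (λ _ → trueJ) evPremises₁ (opcode e) e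
evPremise₂ e = select (λ _ → trueJ) evPremises₂ (opcode e) e
recPremise₁ e = ifz (recCount e) (evJ (recBase e) (recArg e) (recOut e))
                                 (recJ (recBase e) (recStep e) (recArg e) (pred (recCount e)) (witness e))
recPremise₂ e = ifz (recCount e) trueJ
                                 (evJ (recStep e) (pair (pair (recArg e) (pred (recCount e))) (witness e)) (recOut e))
belowPremise₁ e = ifz (belowBound e) trueJ (belowJ (belowCode e) (belowArg e) (pred (belowBound e)))
belowPremise₂ e = ifz (belowBound e) trueJ
                      (evJ (belowCode e) (pair (belowArg e) (pred (belowBound e))) (suc (witness e)))

rulePremises₁ rulePremises₂ : List (ℕ → ℕ)
rulePremises₁ = evPremise₁ ∷ recPremise₁ ∷ belowPremise₁ ∷ []
rulePremises₂ = evPremise₂ ∷ recPremise₂ ∷ belowPremise₂ ∷ []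

premise₁ premise₂ : ℕ → ℕ
premise₁ e = select (λ _ → trueJ) rulePremises₁ (rule e) e
premise₂ e = select (λ _ → trueJ) rulePremises₂ (rule e) e

Concluded : ℕ → List ℕ → Set
Concluded j L = j ≡ trueJ ⊎ Any (λ e → judgement e ≡ j) L

module Derivations (X : Oracle) where

  oracle : ℕ → ℕ
  oracle x = if X x then 1 else 0

  axiomChecks : List (ℕ → ℕ)
  axiomChecks = (λ e → eqN (evOut e) 0) ∷ (λ e → eqN (evOut e) (suc (evIn e))) ∷ (λ e → eqN (evOut e) (evIn e)) ∷
                (λ e → eqN (evOut e) (fst (evIn e))) ∷ (λ e → eqN (evOut e) (snd (evIn e))) ∷
                (λ e → eqN (evOut e) (oracle (evIn e))) ∷
                (λ _ → 0) ∷ (λ _ → 0) ∷ (λ _ → 0) ∷ (λ _ → 0) ∷ []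

  evCheck : ℕ → ℕ
  evCheck e = select (λ e → eqN (evOut e) 0) axiomChecks (opcode e) e

  ruleChecks : List (ℕ → ℕ)
  ruleChecks = evCheck ∷ (λ _ → 0) ∷ (λ _ → 0) ∷ []

  localCheck : ℕ → ℕ
  localCheck e = select (λ _ → 1) ruleChecks (rule e) e

  Valid : List ℕ → Set
  Valid []      = ⊤
  Valid (e ∷ L) = localCheck e ≡ 0 × Concluded (premise₁ e) L × Concluded (premise₂ e) L × Valid L

  Below : Code → ℕ → ℕ → Set
  Below f x y = ∀ z → z < y → Σ[ w ∈ ℕ ] Ev X f (pair x z) (suc w)

  HoldsAt : ℕ → ℕ → Set
  HoldsAt 0 p = Ev X (decode (fst p)) (fst (snd p)) (snd (snd p))
  HoldsAt 1 p = Rec X (decode (fst p)) (decode (fst (snd p))) (fst (snd (snd p)))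
                      (fst (snd (snd (snd p)))) (snd (snd (snd (snd p))))
  HoldsAt 2 p = Below (decode (fst p)) (fst (snd p)) (snd (snd p))
  HoldsAt 3 p = ⊤
  HoldsAt (suc (suc (suc (suc _)))) p = ⊥

  Holds : ℕ → Set
  Holds j = HoldsAt (fst j) (snd j)

  Holds-evJ : ∀ c x y → Holds (evJ c x y) ≡ Ev X (decode c) x y
  Holds-evJ c x y rewrite evJ-def c x y | fst-pair 0 (pair c (pair x y)) | snd-pair 0 (pair c (pair x y))
    | fst-pair c (pair x y) | snd-pair c (pair x y) | fst-pair x y | snd-pair x y = refl

  Holds-recJ : ∀ f g x n y → Holds (recJ f g x n y) ≡ Rec X (decode f) (decode g) x n y
  Holds-recJ f g x n y rewrite recJ-def f g x n y
    | fst-pair 1 (pair f (pair g (pair x (pair n y)))) | snd-pair 1 (pair f (pair g (pair x (pair n y))))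
    | fst-pair f (pair g (pair x (pair n y))) | snd-pair f (pair g (pair x (pair n y)))
    | fst-pair g (pair x (pair n y)) | snd-pair g (pair x (pair n y))
    | fst-pair x (pair n y) | snd-pair x (pair n y) | fst-pair n y | snd-pair n y = refl

  Holds-belowJ : ∀ f x y → Holds (belowJ f x y) ≡ Below (decode f) x y
  Holds-belowJ f x y rewrite belowJ-def f x y | fst-pair 2 (pair f (pair x y)) | snd-pair 2 (pair f (pair x y))
    | fst-pair f (pair x y) | snd-pair f (pair x y) | fst-pair x y | snd-pair x y = refl

  Holds-trueJ : Holds trueJ
  Holds-trueJ rewrite trueJ-def = tt

  holds-ev : ∀ {c x y} → Holds (evJ c x y) → Ev X (decode c) x y
  holds-ev {c} {x} {y} = subst (λ A → A) (Holds-evJ c x y)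

  holds-rec : ∀ {f g x n y} → Holds (recJ f g x n y) → Rec X (decode f) (decode g) x n y
  holds-rec {f} {g} {x} {n} {y} = subst (λ A → A) (Holds-recJ f g x n y)

  holds-below : ∀ {f x y} → Holds (belowJ f x y) → Below (decode f) x y
  holds-below {f} {x} {y} = subst (λ A → A) (Holds-belowJ f x y)

  ev-entry-sound : ∀ e → evCheck e ≡ 0 → Holds (evPremise₁ e) → Holds (evPremise₂ e) →
                   Ev X (decodeStep (opcode e) decode (evCode e)) (evIn e) (evOut e)
  ev-entry-sound e ok h₁ h₂ with opcode e
  ... | 0 = subst (Ev X zer (evIn e)) (sym (eqN-sound _ _ ok)) (ev-zer _)
  ... | 1 = subst (Ev X succ (evIn e)) (sym (eqN-sound _ _ ok)) (ev-succ _)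
  ... | 2 = subst (Ev X ident (evIn e)) (sym (eqN-sound _ _ ok)) (ev-ident _)
  ... | 3 = subst (Ev X fstC (evIn e)) (sym (eqN-sound _ _ ok)) (ev-fst _)
  ... | 4 = subst (Ev X sndC (evIn e)) (sym (eqN-sound _ _ ok)) (ev-snd _)
  ... | 5 = subst (Ev X orc (evIn e)) (sym (eqN-sound _ _ ok)) (ev-orc _)
  ... | 6 = subst (Ev X _ (evIn e)) (pair-unpair (evOut e)) (ev-pr (holds-ev h₁) (holds-ev h₂))
  ... | 7 = ev-comp (holds-ev h₁) (holds-ev h₂)
  ... | 8 = ev-rec (holds-rec h₁)
  ... | 9 = ev-mu (holds-ev h₁) (holds-below h₂)
  ... | suc (suc (suc (suc (suc (suc (suc (suc (suc (suc _))))))))) =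
    subst (Ev X zer (evIn e)) (sym (eqN-sound _ _ ok)) (ev-zer _)

  rec-entry-sound : ∀ e → Holds (recPremise₁ e) → Holds (recPremise₂ e) →
                    Rec X (decode (recBase e)) (decode (recStep e)) (recArg e) (recCount e) (recOut e)
  rec-entry-sound e h₁ h₂ with recCount e
  ... | zero  = rec-0 (holds-ev h₁)
  ... | suc n = rec-S (holds-rec h₁) (holds-ev h₂)

  below-entry-sound : ∀ e → Holds (belowPremise₁ e) → Holds (belowPremise₂ e) →
                      Below (decode (belowCode e)) (belowArg e) (belowBound e)
  below-entry-sound e h₁ h₂ z z<y with belowBound e
  ... | suc y with m≤n⇒m<n∨m≡n (≤-pred z<y)
  ...   | inj₁ z<y′ = holds-below h₁ z z<y′
  ...   | inj₂ refl = witness e , holds-ev h₂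

  entry-sound : ∀ e → localCheck e ≡ 0 → Holds (premise₁ e) → Holds (premise₂ e) → Holds (judgement e)
  entry-sound e ok h₁ h₂ with rule e
  ... | 0 = subst (λ c → Ev X c (evIn e) (evOut e)) (sym (decode-unfold (evCode e))) (ev-entry-sound e ok h₁ h₂)
  ... | 1 = rec-entry-sound e h₁ h₂
  ... | 2 = below-entry-sound e h₁ h₂

  valid-sound : ∀ L → Valid L → All (λ e → Holds (judgement e)) L
  valid-sound []      _                    = []
  valid-sound (e ∷ L) (ok , c₁ , c₂ , v) = entry-sound e ok (concluded-holds c₁) (concluded-holds c₂) ∷ hs
    where
    hs : All (λ e → Holds (judgement e)) L
    hs = valid-sound L v
    concluded-holds : ∀ {j} → Concluded j L → Holds j
    concluded-holds (inj₁ refl) = Holds-trueJ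
    concluded-holds (inj₂ c)    = let h , eq = lookupAny hs c in subst Holds eq h

module Completeness (X : Oracle) where
  open Derivations X

  concluded-++ˡ : ∀ {j L₁} L₂ → Concluded j L₁ → Concluded j (L₁ ++ L₂)
  concluded-++ˡ L₂ (inj₁ j≡true) = inj₁ j≡true
  concluded-++ˡ L₂ (inj₂ c)      = inj₂ (++⁺ˡ c)

  concluded-++ʳ : ∀ {j L₂} L₁ → Concluded j L₂ → Concluded j (L₁ ++ L₂)
  concluded-++ʳ L₁ (inj₁ j≡true) = inj₁ j≡true
  concluded-++ʳ L₁ (inj₂ c)      = inj₂ (++⁺ʳ L₁ c)

  valid-++ : ∀ L₁ L₂ → Valid L₁ → Valid L₂ → Valid (L₁ ++ L₂)
  valid-++ []       L₂ _                   v₂ = v₂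
  valid-++ (e ∷ L₁) L₂ (ok , c₁ , c₂ , v₁) v₂ =
    ok , concluded-++ˡ L₂ c₁ , concluded-++ˡ L₂ c₂ , valid-++ L₁ L₂ v₁ v₂

  Derivable : ℕ → Set
  Derivable j = Σ[ L ∈ List ℕ ] Valid L × Concluded j L

  trueJ-derivable : Derivable trueJ
  trueJ-derivable = [] , tt , inj₁ refl

  derive : ∀ j w → let e = pair j w in
           localCheck e ≡ 0 → Derivable (premise₁ e) → Derivable (premise₂ e) → Derivable j
  derive j w ok (L₁ , v₁ , c₁) (L₂ , v₂ , c₂) =
    pair j w ∷ L₁ ++ L₂ ,
    (ok , concluded-++ˡ L₂ c₁ , concluded-++ʳ L₁ c₂ , valid-++ L₁ L₂ v₁ v₂) ,
    inj₂ (here (fst-pair j w))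

  module EvEntry (c x y w : ℕ) where
    e : ℕ
    e = pair (evJ c x y) w

    args≡ : args e ≡ pair c (pair x y)
    args≡ rewrite fst-pair (evJ c x y) w | evJ-def c x y = snd-pair 0 (pair c (pair x y))

    rule≡ : rule e ≡ 0
    rule≡ rewrite fst-pair (evJ c x y) w | evJ-def c x y = fst-pair 0 (pair c (pair x y))

    evCode≡ : evCode e ≡ c
    evCode≡ rewrite args≡ = fst-pair c (pair x y)

    evIn≡ : evIn e ≡ x
    evIn≡ rewrite args≡ | snd-pair c (pair x y) = fst-pair x y

    evOut≡ : evOut e ≡ y
    evOut≡ rewrite args≡ | snd-pair c (pair x y) = snd-pair x y

    witness≡ : witness e ≡ w
    witness≡ = snd-pair (evJ c x y) w

  module RecEntry (f g x n y w : ℕ) where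
    e : ℕ
    e = pair (recJ f g x n y) w

    args≡ : args e ≡ pair f (pair g (pair x (pair n y)))
    args≡ rewrite fst-pair (recJ f g x n y) w | recJ-def f g x n y = snd-pair 1 (pair f (pair g (pair x (pair n y))))

    rule≡ : rule e ≡ 1
    rule≡ rewrite fst-pair (recJ f g x n y) w | recJ-def f g x n y = fst-pair 1 (pair f (pair g (pair x (pair n y))))

    recBase≡ : recBase e ≡ f
    recBase≡ rewrite args≡ = fst-pair f (pair g (pair x (pair n y)))

    recStep≡ : recStep e ≡ g
    recStep≡ rewrite args≡ | snd-pair f (pair g (pair x (pair n y))) = fst-pair g (pair x (pair n y))

    recArg≡ : recArg e ≡ x
    recArg≡ rewrite args≡ | snd-pair f (pair g (pair x (pair n y))) | snd-pair g (pair x (pair n y)) = fst-pair x (pair n y)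

    recCount≡ : recCount e ≡ n
    recCount≡ rewrite args≡ | snd-pair f (pair g (pair x (pair n y))) | snd-pair g (pair x (pair n y))
                    | snd-pair x (pair n y) = fst-pair n y

    recOut≡ : recOut e ≡ y
    recOut≡ rewrite args≡ | snd-pair f (pair g (pair x (pair n y))) | snd-pair g (pair x (pair n y))
                  | snd-pair x (pair n y) = snd-pair n y

    witness≡ : witness e ≡ w
    witness≡ = snd-pair (recJ f g x n y) w

  module BelowEntry (f x y w : ℕ) where
    e : ℕ
    e = pair (belowJ f x y) w

    args≡ : args e ≡ pair f (pair x y)
    args≡ rewrite fst-pair (belowJ f x y) w | belowJ-def f x y = snd-pair 2 (pair f (pair x y))

    rule≡ : rule e ≡ 2
    rule≡ rewrite fst-pair (belowJ f x y) w | belowJ-def f x y = fst-pair 2 (pair f (pair x y))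

    belowCode≡ : belowCode e ≡ f
    belowCode≡ rewrite args≡ = fst-pair f (pair x y)

    belowArg≡ : belowArg e ≡ x
    belowArg≡ rewrite args≡ | snd-pair f (pair x y) = fst-pair x y

    belowBound≡ : belowBound e ≡ y
    belowBound≡ rewrite args≡ | snd-pair f (pair x y) = snd-pair x y

    witness≡ : witness e ≡ w
    witness≡ = snd-pair (belowJ f x y) w

  evJ-cong : ∀ {c c′ x x′ y y′} → c ≡ c′ → x ≡ x′ → y ≡ y′ → evJ c x y ≡ evJ c′ x′ y′
  evJ-cong refl refl refl = refl

  recJ-cong : ∀ {f f′ g g′ x x′ n n′ y y′} → f ≡ f′ → g ≡ g′ → x ≡ x′ → n ≡ n′ → y ≡ y′ →
              recJ f g x n y ≡ recJ f′ g′ x′ n′ y′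
  recJ-cong refl refl refl refl refl = refl

  belowJ-cong : ∀ {f f′ x x′ y y′} → f ≡ f′ → x ≡ x′ → y ≡ y′ → belowJ f x y ≡ belowJ f′ x′ y′
  belowJ-cong refl refl refl = refl

  derivable-≡ : ∀ {j j′} → j′ ≡ j → Derivable j → Derivable j′
  derivable-≡ j′≡j = subst Derivable (sym j′≡j)

  derive-ev : ∀ c x y w k → fst c ≡ k → let e = pair (evJ c x y) w in
              select (λ e → eqN (evOut e) 0) axiomChecks k e ≡ 0 →
              Derivable (select (λ _ → trueJ) evPremises₁ k e) →
              Derivable (select (λ _ → trueJ) evPremises₂ k e) → Derivable (evJ c x y)
  derive-ev c x y w k fst≡k ok d₁ d₂ =
    derive (evJ c x y) w (trans (at-rule (λ _ → 1) ruleChecks) (trans (at-opcode (λ e → eqN (evOut e) 0) axiomChecks) ok))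
      (derivable-≡ (trans (at-rule (λ _ → trueJ) rulePremises₁) (at-opcode (λ _ → trueJ) evPremises₁)) d₁)
      (derivable-≡ (trans (at-rule (λ _ → trueJ) rulePremises₂) (at-opcode (λ _ → trueJ) evPremises₂)) d₂)
    where
    open EvEntry c x y w
    at-rule : ∀ d fs → select d fs (rule e) e ≡ select d fs 0 e
    at-rule d fs = cong (λ r → select d fs r e) rule≡
    at-opcode : ∀ d fs → select d fs (opcode e) e ≡ select d fs k e
    at-opcode d fs = cong (λ o → select d fs o e) (trans (cong fst evCode≡) fst≡k)

  derive-rec : ∀ f g x n y w → let e = pair (recJ f g x n y) w in
               Derivable (recPremise₁ e) → Derivable (recPremise₂ e) → Derivable (recJ f g x n y)
  derive-rec f g x n y w d₁ d₂ =
    derive (recJ f g x n y) w (at-rule (λ _ → 1) ruleChecks)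
      (derivable-≡ (at-rule (λ _ → trueJ) rulePremises₁) d₁)
      (derivable-≡ (at-rule (λ _ → trueJ) rulePremises₂) d₂)
    where
    open RecEntry f g x n y w
    at-rule : ∀ d fs → select d fs (rule e) e ≡ select d fs 1 e
    at-rule d fs = cong (λ r → select d fs r e) rule≡

  derive-below : ∀ f x y w → let e = pair (belowJ f x y) w in
                 Derivable (belowPremise₁ e) → Derivable (belowPremise₂ e) → Derivable (belowJ f x y)
  derive-below f x y w d₁ d₂ =
    derive (belowJ f x y) w (at-rule (λ _ → 1) ruleChecks)
      (derivable-≡ (at-rule (λ _ → trueJ) rulePremises₁) d₁)
      (derivable-≡ (at-rule (λ _ → trueJ) rulePremises₂) d₂)
    where
    open BelowEntry f x y w
    at-rule : ∀ d fs → select d fs (rule e) e ≡ select d fs 2 e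
    at-rule d fs = cong (λ r → select d fs r e) rule≡

  below-derivable : ∀ f x y → (∀ z → z < y → Σ[ w ∈ ℕ ] Derivable (evJ f (pair x z) (suc w))) →
                    Derivable (belowJ f x y)
  below-derivable f x zero    _     = derive-below f x 0 0 (derivable-≡ premise₁≡ trueJ-derivable)
                                                           (derivable-≡ premise₂≡ trueJ-derivable)
    where
    open BelowEntry f x 0 0
    premise₁≡ : belowPremise₁ e ≡ trueJ
    premise₁≡ rewrite belowBound≡ = refl
    premise₂≡ : belowPremise₂ e ≡ trueJ
    premise₂≡ rewrite belowBound≡ = refl
  below-derivable f x (suc y) below with below y ≤-refl
  ... | v , dᵥ = derive-below f x (suc y) v
                   (derivable-≡ premise₁≡ (below-derivable f x y (λ z z<y → below z (m≤n⇒m≤1+n z<y))))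
                   (derivable-≡ premise₂≡ dᵥ)
    where
    open BelowEntry f x (suc y) v
    premise₁≡ : belowPremise₁ e ≡ belowJ f x y
    premise₁≡ rewrite belowBound≡ | belowCode≡ | belowArg≡ = refl
    premise₂≡ : belowPremise₂ e ≡ evJ f (pair x y) (suc v)
    premise₂≡ rewrite belowBound≡ | belowCode≡ | belowArg≡ | witness≡ = refl

  mutual
    ev-derivable : ∀ c {x y} → Ev X (decode c) x y → Derivable (evJ c x y)
    ev-derivable c d with decode c | codeView c
    ev-derivable c {x} (ev-zer _) | _ | zer-view (inj₁ h) =
      derive-ev c x 0 0 0 h (eqN-complete evOut≡) trueJ-derivable trueJ-derivable
      where open EvEntry c x 0 0
    ev-derivable c {x} (ev-zer _) | _ | zer-view (inj₂ (m , h)) =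
      derive-ev c x 0 0 (10 + m) h (eqN-complete evOut≡) trueJ-derivable trueJ-derivable
      where open EvEntry c x 0 0
    ev-derivable c {x} (ev-succ _) | _ | succ-view h =
      derive-ev c x (suc x) 0 1 h (eqN-complete (trans evOut≡ (cong suc (sym evIn≡)))) trueJ-derivable trueJ-derivable
      where open EvEntry c x (suc x) 0
    ev-derivable c {x} (ev-ident _) | _ | ident-view h =
      derive-ev c x x 0 2 h (eqN-complete (trans evOut≡ (sym evIn≡))) trueJ-derivable trueJ-derivable
      where open EvEntry c x x 0
    ev-derivable c {x} (ev-fst _) | _ | fst-view h =
      derive-ev c x (fst x) 0 3 h (eqN-complete (trans evOut≡ (cong fst (sym evIn≡)))) trueJ-derivable trueJ-derivable
      where open EvEntry c x (fst x) 0
    ev-derivable c {x} (ev-snd _) | _ | snd-view h =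
      derive-ev c x (snd x) 0 4 h (eqN-complete (trans evOut≡ (cong snd (sym evIn≡)))) trueJ-derivable trueJ-derivable
      where open EvEntry c x (snd x) 0
    ev-derivable c {x} (ev-orc _) | _ | orc-view h =
      derive-ev c x (oracle x) 0 5 h (eqN-complete (trans evOut≡ (cong oracle (sym evIn≡)))) trueJ-derivable trueJ-derivable
      where open EvEntry c x (oracle x) 0
    ev-derivable c {x} (ev-pr {a = a} {b} d₁ d₂) | _ | pr-view h =
      derive-ev c x (pair a b) 0 6 h refl
        (derivable-≡ (evJ-cong (cong (λ c → fst (snd c)) evCode≡) evIn≡ (trans (cong fst evOut≡) (fst-pair a b)))
                     (ev-derivable (fst (snd c)) d₁))
        (derivable-≡ (evJ-cong (cong (λ c → snd (snd c)) evCode≡) evIn≡ (trans (cong snd evOut≡) (snd-pair a b)))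
                     (ev-derivable (snd (snd c)) d₂))
      where open EvEntry c x (pair a b) 0
    ev-derivable c {x} {z} (ev-comp {y = v} d₁ d₂) | _ | comp-view h =
      derive-ev c x z v 7 h refl
        (derivable-≡ (evJ-cong (cong (λ c → snd (snd c)) evCode≡) evIn≡ witness≡) (ev-derivable (snd (snd c)) d₁))
        (derivable-≡ (evJ-cong (cong (λ c → fst (snd c)) evCode≡) witness≡ evOut≡) (ev-derivable (fst (snd c)) d₂))
      where open EvEntry c x z v
    ev-derivable c {x} {y} (ev-rec r) | _ | rec-view h =
      derive-ev c x y 0 8 h refl
        (derivable-≡ (recJ-cong (cong (λ c → fst (snd c)) evCode≡) (cong (λ c → snd (snd c)) evCode≡)
                                (cong fst evIn≡) (cong snd evIn≡) evOut≡)
                     (rec-derivable (fst (snd c)) (snd (snd c)) r))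
        trueJ-derivable
      where open EvEntry c x y 0
    ev-derivable c {x} {y} (ev-mu d₀ below) | _ | mu-view h =
      derive-ev c x y 0 9 h refl
        (derivable-≡ (evJ-cong (cong snd evCode≡) (cong₂ pair evIn≡ evOut≡) refl) (ev-derivable (snd c) d₀))
        (derivable-≡ (belowJ-cong (cong snd evCode≡) evIn≡ evOut≡)
                     (below-derivable (snd c) x y (λ z z<y → let w , d = below z z<y in w , ev-derivable (snd c) d)))
      where open EvEntry c x y 0

    rec-derivable : ∀ f g {x n y} → Rec X (decode f) (decode g) x n y → Derivable (recJ f g x n y)
    rec-derivable f g {x} {zero} {y} (rec-0 d) =
      derive-rec f g x 0 y 0 (derivable-≡ premise₁≡ (ev-derivable f d)) (derivable-≡ premise₂≡ trueJ-derivable)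
      where
      open RecEntry f g x 0 y 0
      premise₁≡ : recPremise₁ e ≡ evJ f x y
      premise₁≡ rewrite recCount≡ | recBase≡ | recArg≡ | recOut≡ = refl
      premise₂≡ : recPremise₂ e ≡ trueJ
      premise₂≡ rewrite recCount≡ = refl
    rec-derivable f g {x} {suc n} {z} (rec-S {y = v} r d) =
      derive-rec f g x (suc n) z v (derivable-≡ premise₁≡ (rec-derivable f g r)) (derivable-≡ premise₂≡ (ev-derivable g d))
      where
      open RecEntry f g x (suc n) z v
      premise₁≡ : recPremise₁ e ≡ recJ f g x n v
      premise₁≡ rewrite recCount≡ | recBase≡ | recStep≡ | recArg≡ | witness≡ = refl
      premise₂≡ : recPremise₂ e ≡ evJ g (pair (pair x n) v) z
      premise₂≡ rewrite recCount≡ | recStep≡ | recArg≡ | witness≡ | recOut≡ = refl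

-- On states pair j l, with l the code of a list of entries.
memberStop memberOut memberNext : ℕ → ℕ
memberStop q = ifz (snd q) 0 (eqN (fst (fst (pred (snd q)))) (fst q))
memberOut  q = ifz (snd q) 1 0
memberNext q = pair (fst q) (snd (pred (snd q)))

memberLoop : ℕ → ℕ → ℕ
memberLoop = loop memberStop memberOut memberNext (λ _ → 1)

concludes : ℕ → ℕ → ℕ
concludes j l = ifz (eqN j trueJ) 0 (memberLoop l (pair j l))

memberLoop-[] : ∀ fuel j → memberLoop fuel (pair j 0) ≡ 1
memberLoop-[] zero       j = refl
memberLoop-[] (suc fuel) j rewrite snd-pair j 0 = refl

memberLoop-∷ : ∀ fuel j e L → memberLoop (suc fuel) (pair j (seqCode (e ∷ L))) ≡
                              ifz (eqN (judgement e) j) 0 (memberLoop fuel (pair j (seqCode L)))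
memberLoop-∷ fuel j e L rewrite snd-pair j (seqCode (e ∷ L)) | fst-pair j (seqCode (e ∷ L))
  | fst-pair e (seqCode L) | snd-pair e (seqCode L) with eqN (fst e) j
... | zero  = refl
... | suc _ = refl

memberLoop-sound : ∀ fuel j L → memberLoop fuel (pair j (seqCode L)) ≡ 0 → Any (λ e → judgement e ≡ j) L
memberLoop-sound fuel j [] h rewrite memberLoop-[] fuel j with h
... | ()
memberLoop-sound (suc fuel) j (e ∷ L) h rewrite memberLoop-∷ fuel j e L with eqN (judgement e) j in eq
... | zero  = here (eqN-sound _ _ eq)
... | suc _ = there (memberLoop-sound fuel j L h)

memberLoop-complete : ∀ fuel j L → length L ≤ fuel → Any (λ e → judgement e ≡ j) L →
                      memberLoop fuel (pair j (seqCode L)) ≡ 0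
memberLoop-complete (suc fuel) j (e ∷ L) len≤ (here refl) rewrite memberLoop-∷ fuel j e L | eqN-refl (judgement e) = refl
memberLoop-complete (suc fuel) j (e ∷ L) len≤ (there c) rewrite memberLoop-∷ fuel j e L with eqN (judgement e) j
... | zero  = refl
... | suc _ = memberLoop-complete fuel j L (≤-pred len≤) c

concludes-sound : ∀ j L → concludes j (seqCode L) ≡ 0 → Concluded j L
concludes-sound j L h with eqN j trueJ in eq
... | zero  = inj₁ (eqN-sound j trueJ eq)
... | suc _ = inj₂ (memberLoop-sound (seqCode L) j L h)

concludes-complete : ∀ j L → Concluded j L → concludes j (seqCode L) ≡ 0
concludes-complete j L (inj₁ refl) rewrite eqN-refl trueJ = refl
concludes-complete j L (inj₂ c) with eqN j trueJ
... | zero  = refl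
... | suc _ = memberLoop-complete (seqCode L) j L (length≤seqCode L) c

module Checker (X : Oracle) where
  open Derivations X

  entryOK : ℕ → ℕ → ℕ
  entryOK e l = andN (localCheck e) (andN (concludes (premise₁ e) l) (concludes (premise₂ e) l))

  checkStop checkOut : ℕ → ℕ
  checkStop l = ifz l 0 (ifz (entryOK (fst (pred l)) (snd (pred l))) 1 0)
  checkOut  l = ifz l 0 1

  checkLoop : ℕ → ℕ → ℕ
  checkLoop = loop checkStop checkOut (λ l → snd (pred l)) (λ _ → 0)

  check : ℕ → ℕ
  check l = checkLoop l l

  checkLoop-∷ : ∀ fuel e L → checkLoop (suc fuel) (seqCode (e ∷ L)) ≡
                             ifz (entryOK e (seqCode L)) (checkLoop fuel (seqCode L)) 1
  checkLoop-∷ fuel e L rewrite fst-pair e (seqCode L) | snd-pair e (seqCode L) with entryOK e (seqCode L)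
  ... | zero  = refl
  ... | suc _ = refl

  entryOK-sound : ∀ e L → entryOK e (seqCode L) ≡ 0 →
                  localCheck e ≡ 0 × Concluded (premise₁ e) L × Concluded (premise₂ e) L
  entryOK-sound e L ok =
    let ok₀ , ok₁₂ = andN-sound _ _ ok
        ok₁ , ok₂  = andN-sound _ _ ok₁₂
    in ok₀ , concludes-sound (premise₁ e) L ok₁ , concludes-sound (premise₂ e) L ok₂

  checkLoop-sound : ∀ fuel L → length L ≤ fuel → checkLoop fuel (seqCode L) ≡ 0 → Valid L
  checkLoop-sound fuel       []      _    _ = tt
  checkLoop-sound (suc fuel) (e ∷ L) len≤ h rewrite checkLoop-∷ fuel e L with entryOK e (seqCode L) in ok
  ... | zero = let ok₀ , c₁ , c₂ = entryOK-sound e L ok in ok₀ , c₁ , c₂ , checkLoop-sound fuel L (≤-pred len≤) h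

  check-sound : ∀ L → check (seqCode L) ≡ 0 → Valid L
  check-sound L = checkLoop-sound (seqCode L) L (length≤seqCode L)

  checkLoop-complete : ∀ fuel L → Valid L → checkLoop fuel (seqCode L) ≡ 0
  checkLoop-complete zero       L       _                   = refl
  checkLoop-complete (suc fuel) []      _                   = refl
  checkLoop-complete (suc fuel) (e ∷ L) (ok₀ , c₁ , c₂ , v)
    rewrite checkLoop-∷ fuel e L | ok₀ | concludes-complete _ L c₁ | concludes-complete _ L c₂ =
    checkLoop-complete fuel L v

  check-complete : ∀ L → Valid L → check (seqCode L) ≡ 0
  check-complete L = checkLoop-complete (seqCode L) L

  open Computable X

  evJᶜ : ∀ {c x y} → Computable c → Computable x → Computable y → Computable (λ q → evJ (c q) (x q) (y q))
  evJᶜ {c} {x} {y} cᶜ xᶜ yᶜ =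
    computable-ext ⟨ constᶜ 0 , ⟨ cᶜ , ⟨ xᶜ , yᶜ ⟩ᶜ ⟩ᶜ ⟩ᶜ λ q → sym (evJ-def (c q) (x q) (y q))

  recJᶜ : ∀ {f g x n y} → Computable f → Computable g → Computable x → Computable n → Computable y →
          Computable (λ q → recJ (f q) (g q) (x q) (n q) (y q))
  recJᶜ {f} {g} {x} {n} {y} fᶜ gᶜ xᶜ nᶜ yᶜ =
    computable-ext ⟨ constᶜ 1 , ⟨ fᶜ , ⟨ gᶜ , ⟨ xᶜ , ⟨ nᶜ , yᶜ ⟩ᶜ ⟩ᶜ ⟩ᶜ ⟩ᶜ ⟩ᶜ
      λ q → sym (recJ-def (f q) (g q) (x q) (n q) (y q))

  belowJᶜ : ∀ {f x y} → Computable f → Computable x → Computable y → Computable (λ q → belowJ (f q) (x q) (y q))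
  belowJᶜ {f} {x} {y} fᶜ xᶜ yᶜ =
    computable-ext ⟨ constᶜ 2 , ⟨ fᶜ , ⟨ xᶜ , yᶜ ⟩ᶜ ⟩ᶜ ⟩ᶜ λ q → sym (belowJ-def (f q) (x q) (y q))

  trueJᶜ : Computable (λ _ → trueJ)
  trueJᶜ = computable-ext (constᶜ (pair 3 0)) λ _ → sym trueJ-def

  witnessᶜ : Computable witness
  witnessᶜ = sndᶜ

  ruleᶜ : Computable rule
  ruleᶜ = fstᶜ ∘ᶜ fstᶜ

  argsᶜ : Computable args
  argsᶜ = sndᶜ ∘ᶜ fstᶜ

  evCodeᶜ : Computable evCode
  evCodeᶜ = fstᶜ ∘ᶜ argsᶜ

  evInᶜ : Computable evIn
  evInᶜ = fstᶜ ∘ᶜ sndᶜ ∘ᶜ argsᶜ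

  evOutᶜ : Computable evOut
  evOutᶜ = sndᶜ ∘ᶜ sndᶜ ∘ᶜ argsᶜ

  opcodeᶜ : Computable opcode
  opcodeᶜ = fstᶜ ∘ᶜ evCodeᶜ

  sub₁ᶜ : Computable sub₁
  sub₁ᶜ = fstᶜ ∘ᶜ sndᶜ ∘ᶜ evCodeᶜ

  sub₂ᶜ : Computable sub₂
  sub₂ᶜ = sndᶜ ∘ᶜ sndᶜ ∘ᶜ evCodeᶜ

  subμᶜ : Computable subμ
  subμᶜ = sndᶜ ∘ᶜ evCodeᶜ

  recBaseᶜ : Computable recBase
  recBaseᶜ = fstᶜ ∘ᶜ argsᶜ

  belowCodeᶜ : Computable belowCode
  belowCodeᶜ = fstᶜ ∘ᶜ argsᶜ

  belowArgᶜ : Computable belowArg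
  belowArgᶜ = fstᶜ ∘ᶜ sndᶜ ∘ᶜ argsᶜ

  belowBoundᶜ : Computable belowBound
  belowBoundᶜ = sndᶜ ∘ᶜ sndᶜ ∘ᶜ argsᶜ

  recCountᶜ : Computable recCount
  recCountᶜ = fstᶜ ∘ᶜ sndᶜ ∘ᶜ sndᶜ ∘ᶜ sndᶜ ∘ᶜ argsᶜ

  recOutᶜ : Computable recOut
  recOutᶜ = sndᶜ ∘ᶜ sndᶜ ∘ᶜ sndᶜ ∘ᶜ sndᶜ ∘ᶜ argsᶜ

  recArgᶜ : Computable recArg
  recArgᶜ = fstᶜ ∘ᶜ sndᶜ ∘ᶜ sndᶜ ∘ᶜ argsᶜ

  recStepᶜ : Computable recStep
  recStepᶜ = fstᶜ ∘ᶜ sndᶜ ∘ᶜ argsᶜ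

  localCheckᶜ : Computable localCheck
  localCheckᶜ = selectᶜ ruleChecks (constᶜ 1) (evCheckᶜ ∷ constᶜ 0 ∷ constᶜ 0 ∷ []) ruleᶜ
    where
    evCheckᶜ : Computable evCheck
    evCheckᶜ = selectᶜ axiomChecks (eqNᶜ evOutᶜ (constᶜ 0))
      (eqNᶜ evOutᶜ (constᶜ 0) ∷ eqNᶜ evOutᶜ (sucᶜ ∘ᶜ evInᶜ) ∷ eqNᶜ evOutᶜ evInᶜ ∷
       eqNᶜ evOutᶜ (fstᶜ ∘ᶜ evInᶜ) ∷ eqNᶜ evOutᶜ (sndᶜ ∘ᶜ evInᶜ) ∷ eqNᶜ evOutᶜ (oracleᶜ ∘ᶜ evInᶜ) ∷
       constᶜ 0 ∷ constᶜ 0 ∷ constᶜ 0 ∷ constᶜ 0 ∷ []) (fstᶜ ∘ᶜ evCodeᶜ)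

  premise₁ᶜ : Computable premise₁
  premise₁ᶜ = selectᶜ rulePremises₁ trueJᶜ (evPremise₁ᶜ ∷ recPremise₁ᶜ ∷ belowPremise₁ᶜ ∷ []) ruleᶜ
    where
    evPremise₁ᶜ : Computable evPremise₁
    evPremise₁ᶜ = selectᶜ evPremises₁ trueJᶜ
      (trueJᶜ ∷ trueJᶜ ∷ trueJᶜ ∷ trueJᶜ ∷ trueJᶜ ∷ trueJᶜ ∷
       evJᶜ sub₁ᶜ evInᶜ (fstᶜ ∘ᶜ evOutᶜ) ∷
       evJᶜ sub₂ᶜ evInᶜ witnessᶜ ∷
       recJᶜ sub₁ᶜ sub₂ᶜ (fstᶜ ∘ᶜ evInᶜ) (sndᶜ ∘ᶜ evInᶜ) evOutᶜ ∷
       evJᶜ subμᶜ ⟨ evInᶜ , evOutᶜ ⟩ᶜ (constᶜ 0) ∷ []) opcodeᶜ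
    recPremise₁ᶜ : Computable recPremise₁
    recPremise₁ᶜ = ifzᶜ recCountᶜ (evJᶜ recBaseᶜ recArgᶜ recOutᶜ)
                                  (recJᶜ recBaseᶜ recStepᶜ recArgᶜ (predᶜ ∘ᶜ recCountᶜ) witnessᶜ)
    belowPremise₁ᶜ : Computable belowPremise₁
    belowPremise₁ᶜ = ifzᶜ belowBoundᶜ trueJᶜ (belowJᶜ belowCodeᶜ belowArgᶜ (predᶜ ∘ᶜ belowBoundᶜ))

  premise₂ᶜ : Computable premise₂
  premise₂ᶜ = selectᶜ rulePremises₂ trueJᶜ (evPremise₂ᶜ ∷ recPremise₂ᶜ ∷ belowPremise₂ᶜ ∷ []) ruleᶜ
    where
    evPremise₂ᶜ : Computable evPremise₂
    evPremise₂ᶜ = selectᶜ evPremises₂ trueJᶜ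
      (trueJᶜ ∷ trueJᶜ ∷ trueJᶜ ∷ trueJᶜ ∷ trueJᶜ ∷ trueJᶜ ∷
       evJᶜ sub₂ᶜ evInᶜ (sndᶜ ∘ᶜ evOutᶜ) ∷
       evJᶜ sub₁ᶜ witnessᶜ evOutᶜ ∷
       trueJᶜ ∷
       belowJᶜ subμᶜ evInᶜ evOutᶜ ∷ []) opcodeᶜ
    recPremise₂ᶜ : Computable recPremise₂
    recPremise₂ᶜ = ifzᶜ recCountᶜ trueJᶜ
                     (evJᶜ recStepᶜ ⟨ ⟨ recArgᶜ , predᶜ ∘ᶜ recCountᶜ ⟩ᶜ , witnessᶜ ⟩ᶜ recOutᶜ)
    belowPremise₂ᶜ : Computable belowPremise₂
    belowPremise₂ᶜ = ifzᶜ belowBoundᶜ trueJᶜ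
                       (evJᶜ belowCodeᶜ ⟨ belowArgᶜ , predᶜ ∘ᶜ belowBoundᶜ ⟩ᶜ (sucᶜ ∘ᶜ witnessᶜ))

  memberLoopᶜ : Computable₂ memberLoop
  memberLoopᶜ = loopᶜ (ifzᶜ sndᶜ (constᶜ 0) (eqNᶜ (fstᶜ ∘ᶜ fstᶜ ∘ᶜ predᶜ ∘ᶜ sndᶜ) fstᶜ))
                      (ifzᶜ sndᶜ (constᶜ 1) (constᶜ 0))
                      ⟨ fstᶜ , sndᶜ ∘ᶜ predᶜ ∘ᶜ sndᶜ ⟩ᶜ (constᶜ 1)

  concludesᶜ : ∀ {j l} → Computable j → Computable l → Computable (λ q → concludes (j q) (l q))
  concludesᶜ {j} {l} jᶜ lᶜ = ifzᶜ (eqNᶜ jᶜ trueJᶜ) (constᶜ 0)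
    (computable-ext (memberLoopᶜ ∘ᶜ ⟨ lᶜ , ⟨ jᶜ , lᶜ ⟩ᶜ ⟩ᶜ)
      λ q → cong₂ memberLoop (fst-pair (l q) (pair (j q) (l q))) (snd-pair (l q) (pair (j q) (l q))))

  checkᶜ : Computable check
  checkᶜ = computable-ext (checkLoopᶜ ∘ᶜ ⟨ idᶜ , idᶜ ⟩ᶜ) λ l → cong₂ checkLoop (fst-pair l l) (snd-pair l l)
    where
    entryOKᶜ : Computable₂ entryOK
    entryOKᶜ = andNᶜ (localCheckᶜ ∘ᶜ fstᶜ)
                     (andNᶜ (concludesᶜ (premise₁ᶜ ∘ᶜ fstᶜ) sndᶜ) (concludesᶜ (premise₂ᶜ ∘ᶜ fstᶜ) sndᶜ))
    checkStopᶜ : Computable checkStop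
    checkStopᶜ = ifzᶜ idᶜ (constᶜ 0)
                   (ifzᶜ (apply₂ᶜ entryOK entryOKᶜ (fstᶜ ∘ᶜ predᶜ) (sndᶜ ∘ᶜ predᶜ)) (constᶜ 1) (constᶜ 0))
    checkLoopᶜ : Computable₂ checkLoop
    checkLoopᶜ = loopᶜ checkStopᶜ (ifzᶜ idᶜ (constᶜ 0) (constᶜ 1)) (sndᶜ ∘ᶜ predᶜ) (constᶜ 0)

module Search (X : Oracle) where
  open Derivations X
  open Completeness X
  open Checker X

  headJudgement headRule headCode headInput derivedValue : ℕ → ℕ
  headJudgement d = judgement (fst (pred d))
  headRule      d = fst (headJudgement d)
  headCode      d = fst (snd (headJudgement d))
  headInput     d = fst (snd (snd (headJudgement d)))
  derivedValue  d = snd (snd (snd (headJudgement d)))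

  isDerivationOf : ℕ → ℕ → ℕ
  isDerivationOf env d =
    ifz d 1 (andN (check d) (andN (headRule d) (andN (eqN (headCode d) (fst env)) (eqN (headInput d) (snd env)))))

  head-holds : ∀ d → 0 < d → check d ≡ 0 → Holds (headJudgement d)
  head-holds d 0<d ok with seqCode-surjective d
  head-holds .(seqCode (e ∷ L)) _ ok | e ∷ L , refl with valid-sound (e ∷ L) (check-sound (e ∷ L) ok)
  ... | holds ∷ _ rewrite fst-pair e (seqCode L) = holds

  isDerivationOf-sound : ∀ a m d → isDerivationOf (pair a m) d ≡ 0 → Ev X (decode a) m (derivedValue d)
  isDerivationOf-sound a m (suc d) ok =
    let checked , ok₁   = andN-sound (check (suc d)) _ ok
        rule≡0 , ok₂    = andN-sound (headRule (suc d)) _ ok₁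
        code≡ , input≡  = andN-sound (eqN (headCode (suc d)) (fst (pair a m))) _ ok₂
        holds           = head-holds (suc d) (s≤s z≤n) checked
    in subst₂ (λ c x → Ev X (decode c) x (derivedValue (suc d)))
              (trans (eqN-sound _ _ code≡) (fst-pair a m))
              (trans (eqN-sound _ _ input≡) (snd-pair a m))
              (subst (λ r → HoldsAt r (snd (headJudgement (suc d)))) rule≡0 holds)

  valid-suffix : ∀ {P : ℕ → Set} L → Valid L → Any P L → Σ[ e ∈ ℕ ] Σ[ L′ ∈ List ℕ ] P e × Valid (e ∷ L′)
  valid-suffix (e ∷ L) v               (here p)  = e , L , p , v
  valid-suffix (e ∷ L) (_ , _ , _ , v) (there c) = valid-suffix L v c

  evJ≢trueJ : ∀ c x y → evJ c x y ≢ trueJ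
  evJ≢trueJ c x y eq = 0≢1+n (begin
    0                                 ≡⟨ sym (fst-pair 0 (pair c (pair x y))) ⟩
    fst (pair 0 (pair c (pair x y)))  ≡⟨ cong fst (sym (evJ-def c x y)) ⟩
    fst (evJ c x y)                   ≡⟨ cong fst (trans eq trueJ-def) ⟩
    fst (pair 3 0)                    ≡⟨ fst-pair 3 0 ⟩
    3                                 ∎)
    where open ≡-Reasoning

  isDerivationOf-complete : ∀ a m y → Ev X (decode a) m y → Σ[ d ∈ ℕ ] isDerivationOf (pair a m) d ≡ 0
  isDerivationOf-complete a m y ev with ev-derivable a ev
  ... | L , v , inj₁ eq = ⊥-elim (evJ≢trueJ a m y eq)
  ... | L , v , inj₂ c with valid-suffix L v c
  ...   | e , L′ , concludes-ev , v′ = seqCode (e ∷ L′) , passes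
    where
    passes : isDerivationOf (pair a m) (seqCode (e ∷ L′)) ≡ 0
    passes rewrite check-complete (e ∷ L′) v′ | fst-pair e (seqCode L′) | concludes-ev | evJ-def a m y
      | fst-pair 0 (pair a (pair m y)) | snd-pair 0 (pair a (pair m y)) | fst-pair a (pair m y)
      | snd-pair a (pair m y) | fst-pair m y | fst-pair a m | snd-pair a m | eqN-refl a | eqN-refl m = refl

  searchLoop : ℕ → ℕ → ℕ
  searchLoop = loop (λ q → isDerivationOf (fst q) (snd q)) (λ q → suc (derivedValue (snd q)))
                    (λ q → pair (fst q) (suc (snd q))) (λ _ → 0)

  searchLoop-suc : ∀ fuel env k → searchLoop (suc fuel) (pair env k) ≡
                   ifz (isDerivationOf env k) (suc (derivedValue k)) (searchLoop fuel (pair env (suc k)))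
  searchLoop-suc fuel env k rewrite fst-pair env k | snd-pair env k = refl

  searchLoop-sound : ∀ fuel env k y → searchLoop fuel (pair env k) ≡ suc y →
                     Σ[ d ∈ ℕ ] isDerivationOf env d ≡ 0 × derivedValue d ≡ y
  searchLoop-sound (suc fuel) env k y h rewrite searchLoop-suc fuel env k with isDerivationOf env k in found
  ... | zero  = k , found , suc-injective h
  ... | suc _ = searchLoop-sound fuel env (suc k) y h

  searchLoop-finds : ∀ fuel env k i → i < fuel → isDerivationOf env (i + k) ≡ 0 →
                     Σ[ d ∈ ℕ ] isDerivationOf env d ≡ 0 × searchLoop fuel (pair env k) ≡ suc (derivedValue d)
  searchLoop-finds (suc fuel) env k i i<fuel h rewrite searchLoop-suc fuel env k with isDerivationOf env k in found
  ... | zero = k , found , refl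
  searchLoop-finds (suc fuel) env k zero    _      h | suc _ with trans (sym found) h
  ... | ()
  searchLoop-finds (suc fuel) env k (suc i) i<fuel h | suc _ =
    searchLoop-finds fuel env (suc k) i (≤-pred i<fuel) (subst (λ d → isDerivationOf env d ≡ 0) (sym (+-suc i k)) h)

  open Computable X

  searchLoopᶜ : Computable₂ searchLoop
  searchLoopᶜ = loopᶜ isDerivationOfᶜ (sucᶜ ∘ᶜ derivedValueᶜ ∘ᶜ sndᶜ) ⟨ fstᶜ , sucᶜ ∘ᶜ sndᶜ ⟩ᶜ (constᶜ 0)
    where
    headJudgementᶜ : Computable headJudgement
    headJudgementᶜ = fstᶜ ∘ᶜ fstᶜ ∘ᶜ predᶜ
    derivedValueᶜ : Computable derivedValue
    derivedValueᶜ = sndᶜ ∘ᶜ sndᶜ ∘ᶜ sndᶜ ∘ᶜ headJudgementᶜ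
    isDerivationOfᶜ : Computable₂ isDerivationOf
    isDerivationOfᶜ =
      ifzᶜ sndᶜ (constᶜ 1) (andNᶜ (checkᶜ ∘ᶜ sndᶜ) (andNᶜ (fstᶜ ∘ᶜ headJudgementᶜ ∘ᶜ sndᶜ)
        (andNᶜ (eqNᶜ (fstᶜ ∘ᶜ sndᶜ ∘ᶜ headJudgementᶜ ∘ᶜ sndᶜ) (fstᶜ ∘ᶜ fstᶜ))
               (eqNᶜ (fstᶜ ∘ᶜ sndᶜ ∘ᶜ sndᶜ ∘ᶜ headJudgementᶜ ∘ᶜ sndᶜ) (sndᶜ ∘ᶜ fstᶜ)))))

  opaque
    search : ℕ → ℕ → ℕ
    search bound env = searchLoop bound (pair env 0)

    search-sound : ∀ bound a m y → search bound (pair a m) ≡ suc y → Ev X (decode a) m y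
    search-sound bound a m y h with searchLoop-sound bound (pair a m) 0 y h
    ... | d , found , refl = isDerivationOf-sound a m d found

    search-complete : ∀ a m y → Ev X (decode a) m y → Σ[ D ∈ ℕ ] ∀ bound → D < bound → search bound (pair a m) ≡ suc y
    search-complete a m y ev with isDerivationOf-complete a m y ev
    ... | D , found = D , finds
      where
      finds : ∀ bound → D < bound → search bound (pair a m) ≡ suc y
      finds bound D<bound
        with searchLoop-finds bound (pair a m) 0 D D<bound
               (subst (λ d → isDerivationOf (pair a m) d ≡ 0) (sym (+-identityʳ D)) found)
      ... | d , found′ , result = trans result (cong suc (Ev-deterministic (isDerivationOf-sound a m d found′) ev))

    searchᶜ : ∀ {b env} → Computable b → Computable env → Computable (λ x → search (b x) (env x))
    searchᶜ {b} {env} bᶜ envᶜ = computable-ext (searchLoopᶜ ∘ᶜ ⟨ bᶜ , ⟨ envᶜ , constᶜ 0 ⟩ᶜ ⟩ᶜ)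
      λ x → cong₂ searchLoop (fst-pair (b x) (pair (env x) 0)) (snd-pair (b x) (pair (env x) 0))

data QueryShape (c : ℕ) : Set where
  empty        : c ≡ 0 → QueryShape c
  no-argument  : ∀ n → c ≡ suc (pair n 0) → QueryShape c
  argument     : ∀ n m rest → c ≡ suc (pair n (suc (pair m rest))) → QueryShape c

queryShape : ∀ c → QueryShape c
queryShape zero = empty refl
queryShape (suc p) with snd p in snd≡
... | zero  = no-argument (fst p) (cong suc (trans (sym (pair-unpair p)) (cong (pair (fst p)) snd≡)))
... | suc r = argument (fst p) (fst r) (snd r)
                (cong suc (trans (sym (pair-unpair p)) (cong (pair (fst p)) (trans snd≡ (cong suc (sym (pair-unpair r)))))))

-- On the code c of a query ⟨n, m, …⟩, embed a c searches below c for a derivation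
-- of Φ_a(m) = y and answers suc (embed y n).  The recursion on n runs as a loop on
-- states pair acc (pair a c), acc counting the suc's still owed.
module Embedding (X : Oracle) where
  open Search X

  owed source queryCode queryIndex queryRest queryArg found : ℕ → ℕ
  owed       s = fst s
  source     s = fst (snd s)
  queryCode  s = snd (snd s)
  queryIndex s = fst (pred (queryCode s))
  queryRest  s = snd (pred (queryCode s))
  queryArg   s = fst (pred (queryRest s))
  found      s = search (queryCode s) (pair (source s) (queryArg s))

  embedStop embedOut embedNext : ℕ → ℕ
  embedStop s = ifz (queryCode s) 0 (ifz (queryRest s) 0 (ifz (found s) 0 1))
  embedOut  s = ifz (queryCode s) (owed s + source s) (owed s)
  embedNext s = pair (suc (owed s)) (pair (pred (found s)) (queryIndex s))

  embedLoop : ℕ → ℕ → ℕ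
  embedLoop = loop embedStop embedOut embedNext owed

  embedLoop-empty : ∀ fuel acc a → embedLoop (suc fuel) (pair acc (pair a 0)) ≡ acc + a
  embedLoop-empty fuel acc a
    rewrite snd-pair acc (pair a 0) | snd-pair a 0 | fst-pair a 0 | fst-pair acc (pair a 0) = refl

  embedLoop-no-argument : ∀ fuel acc a n → embedLoop (suc fuel) (pair acc (pair a (suc (pair n 0)))) ≡ acc
  embedLoop-no-argument fuel acc a n
    rewrite snd-pair acc (pair a (suc (pair n 0))) | snd-pair a (suc (pair n 0)) | snd-pair n 0
          | fst-pair acc (pair a (suc (pair n 0))) = refl

  embedLoop-argument : ∀ fuel acc a n m rest → let c = suc (pair n (suc (pair m rest))) in
    embedLoop (suc fuel) (pair acc (pair a c)) ≡
    ifz (search c (pair a m)) acc (embedLoop fuel (pair (suc acc) (pair (pred (search c (pair a m))) n)))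
  embedLoop-argument fuel acc a n m rest
    rewrite snd-pair acc (pair a (suc (pair n (suc (pair m rest))))) | snd-pair a (suc (pair n (suc (pair m rest))))
          | fst-pair acc (pair a (suc (pair n (suc (pair m rest))))) | fst-pair a (suc (pair n (suc (pair m rest))))
          | snd-pair n (suc (pair m rest)) | fst-pair n (suc (pair m rest)) | fst-pair m rest
    with search (suc (pair n (suc (pair m rest)))) (pair a m)
  ... | zero  = refl
  ... | suc y = refl

  embedLoop-owed : ∀ fuel acc a c → embedLoop fuel (pair acc (pair a c)) ≡ acc + embedLoop fuel (pair 0 (pair a c))
  embedLoop-owed zero acc a c =
    trans (fst-pair acc (pair a c)) (trans (sym (+-identityʳ acc)) (cong (acc +_) (sym (fst-pair 0 (pair a c)))))
  embedLoop-owed (suc fuel) acc a c with queryShape c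
  ... | empty refl = trans (embedLoop-empty fuel acc a) (cong (acc +_) (sym (embedLoop-empty fuel 0 a)))
  ... | no-argument n refl =
    trans (embedLoop-no-argument fuel acc a n) (trans (sym (+-identityʳ acc)) (cong (acc +_) (sym (embedLoop-no-argument fuel 0 a n))))
  ... | argument n m rest refl =
    trans (embedLoop-argument fuel acc a n m rest)
          (trans (step (search (suc (pair n (suc (pair m rest)))) (pair a m)))
                 (cong (acc +_) (sym (embedLoop-argument fuel 0 a n m rest))))
    where
    step : ∀ k → ifz k acc (embedLoop fuel (pair (suc acc) (pair (pred k) n))) ≡
                 acc + ifz k 0 (embedLoop fuel (pair 1 (pair (pred k) n)))
    step zero    = sym (+-identityʳ acc)
    step (suc y) = begin
      embedLoop fuel (pair (suc acc) (pair y n))           ≡⟨ embedLoop-owed fuel (suc acc) y n ⟩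
      suc acc + embedLoop fuel (pair 0 (pair y n))         ≡⟨ sym (+-suc acc _) ⟩
      acc + (1 + embedLoop fuel (pair 0 (pair y n)))       ≡⟨ cong (acc +_) (sym (embedLoop-owed fuel 1 y n)) ⟩
      acc + embedLoop fuel (pair 1 (pair y n))             ∎
      where open ≡-Reasoning

  embedLoop-fuel : ∀ f f′ acc a c → c < f → c < f′ → embedLoop f (pair acc (pair a c)) ≡ embedLoop f′ (pair acc (pair a c))
  embedLoop-fuel (suc f) (suc f′) acc a c c<f c<f′ with queryShape c
  ... | empty refl = trans (embedLoop-empty f acc a) (sym (embedLoop-empty f′ acc a))
  ... | no-argument n refl = trans (embedLoop-no-argument f acc a n) (sym (embedLoop-no-argument f′ acc a n))
  ... | argument n m rest refl =
    trans (embedLoop-argument f acc a n m rest)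
          (trans (step (search (suc (pair n (suc (pair m rest)))) (pair a m))) (sym (embedLoop-argument f′ acc a n m rest)))
    where
    n< : ∀ {g} → suc (pair n (suc (pair m rest))) < suc g → n < g
    n< c<g = ≤-<-trans (a≤pair[a,b] n _) (≤-pred c<g)
    step : ∀ k → ifz k acc (embedLoop f  (pair (suc acc) (pair (pred k) n))) ≡
                 ifz k acc (embedLoop f′ (pair (suc acc) (pair (pred k) n)))
    step zero    = refl
    step (suc y) = embedLoop-fuel f f′ (suc acc) y n (n< c<f) (n< c<f′)

  open Computable X

  embedLoopᶜ : Computable₂ embedLoop
  embedLoopᶜ = loopᶜ (ifzᶜ queryCodeᶜ (constᶜ 0) (ifzᶜ queryRestᶜ (constᶜ 0) (ifzᶜ foundᶜ (constᶜ 0) (constᶜ 1))))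
                     (ifzᶜ queryCodeᶜ (apply₂ᶜ _+_ addᶜ owedᶜ sourceᶜ) owedᶜ)
                     ⟨ sucᶜ ∘ᶜ owedᶜ , ⟨ predᶜ ∘ᶜ foundᶜ , queryIndexᶜ ⟩ᶜ ⟩ᶜ
                     owedᶜ
    where
    owedᶜ : Computable owed
    owedᶜ = fstᶜ
    sourceᶜ : Computable source
    sourceᶜ = fstᶜ ∘ᶜ sndᶜ
    queryCodeᶜ : Computable queryCode
    queryCodeᶜ = sndᶜ ∘ᶜ sndᶜ
    queryIndexᶜ : Computable queryIndex
    queryIndexᶜ = fstᶜ ∘ᶜ predᶜ ∘ᶜ queryCodeᶜ
    queryRestᶜ : Computable queryRest
    queryRestᶜ = sndᶜ ∘ᶜ predᶜ ∘ᶜ queryCodeᶜ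
    queryArgᶜ : Computable queryArg
    queryArgᶜ = fstᶜ ∘ᶜ predᶜ ∘ᶜ queryRestᶜ
    foundᶜ : Computable found
    foundᶜ = searchᶜ queryCodeᶜ ⟨ sourceᶜ , queryArgᶜ ⟩ᶜ

  opaque
    embed : ℕ → Baire
    embed a c = embedLoop (suc c) (pair 0 (pair a c))

    embed-empty : ∀ a → embed a 0 ≡ a
    embed-empty a = embedLoop-empty 0 0 a

    embed-no-argument : ∀ a n → embed a (suc (pair n 0)) ≡ 0
    embed-no-argument a n = embedLoop-no-argument (suc (pair n 0)) 0 a n

    embed-argument : ∀ a n m rest → let c = suc (pair n (suc (pair m rest))) in
                     (search c (pair a m) ≡ 0 × embed a c ≡ 0) ⊎
                     (Σ[ y ∈ ℕ ] search c (pair a m) ≡ suc y × embed a c ≡ suc (embed y n))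
    embed-argument a n m rest = by-result (search c (pair a m)) refl
      where
      c : ℕ
      c = suc (pair n (suc (pair m rest)))
      continue : ℕ → ℕ
      continue k = ifz k 0 (embedLoop c (pair 1 (pair (pred k) n)))
      by-result : ∀ k → search c (pair a m) ≡ k →
                  (search c (pair a m) ≡ 0 × embed a c ≡ 0) ⊎
                  (Σ[ y ∈ ℕ ] search c (pair a m) ≡ suc y × embed a c ≡ suc (embed y n))
      by-result zero    found = inj₁ (found , trans (embedLoop-argument c 0 a n m rest) (cong continue found))
      by-result (suc y) found = inj₂ (y , found , (begin
        embed a c                                  ≡⟨ embedLoop-argument c 0 a n m rest ⟩
        continue (search c (pair a m))             ≡⟨ cong continue found ⟩
        embedLoop c (pair 1 (pair y n))            ≡⟨ embedLoop-owed c 1 y n ⟩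
        suc (embedLoop c (pair 0 (pair y n)))      ≡⟨ cong suc (embedLoop-fuel c (suc n) 0 y n (s≤s (a≤pair[a,b] n _)) ≤-refl) ⟩
        suc (embed y n)                            ∎))
        where open ≡-Reasoning

    embedᶜ : Computable₂ embed
    embedᶜ = computable-ext (embedLoopᶜ ∘ᶜ ⟨ sucᶜ ∘ᶜ sndᶜ , ⟨ constᶜ 0 , ⟨ fstᶜ , sndᶜ ⟩ᶜ ⟩ᶜ ⟩ᶜ)
      λ q → cong₂ embedLoop (fst-pair (suc (snd q)) (pair 0 (pair (fst q) (snd q))))
                            (snd-pair (suc (snd q)) (pair 0 (pair (fst q) (snd q))))

k<query : ∀ n g k → k < query n g k
k<query n g k = subst (_≤ query n g k) length≡ (length≤seqCode (n ∷ map g (upTo k)))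
  where
  length≡ : length (n ∷ map g (upTo k)) ≡ suc k
  length≡ = cong suc (trans (length-map g (upTo k)) (length-applyUpTo (λ i → i) k))

query-cong : ∀ n {g g′} → (∀ i → g i ≡ g′ i) → ∀ k → query n g k ≡ query n g′ k
query-cong n g≗g′ k = cong (λ l → seqCode (n ∷ l)) (map-cong g≗g′ (upTo k))

first-nonzero : ∀ (v : ℕ → ℕ) K z → v K ≡ suc z →
                Σ[ k ∈ ℕ ] (∀ j → j < k → v j ≡ 0) × Σ[ z′ ∈ ℕ ] v k ≡ suc z′
first-nonzero v K z vK≡ with v 0 in v0≡
... | suc z′ = 0 , (λ _ ()) , z′ , v0≡
first-nonzero v zero z vK≡ | zero with trans (sym v0≡) vK≡
... | ()
first-nonzero v (suc K) z vK≡ | zero with first-nonzero (λ i → v (suc i)) K z vK≡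
... | k , zeros , z′ , vk≡ = suc k , below , z′ , vk≡
  where
  below : ∀ j → j < suc k → v j ≡ 0
  below zero    _         = v0≡
  below (suc j) (s≤s j<k) = zeros j j<k

App2-cong : ∀ {f f′ g g′ h h′} → (∀ i → f i ≡ f′ i) → (∀ i → g i ≡ g′ i) → (∀ i → h i ≡ h′ i) →
            App2 f g h → App2 f′ g′ h′
App2-cong {f} f≗f′ g≗g′ h≗h′ app n =
  let k , zeros , hit = app n
      same-query = λ j → trans (sym (f≗f′ _)) (cong f (query-cong n (λ i → sym (g≗g′ i)) j))
  in k , (λ j j<k → trans (same-query j) (zeros j j<k)) , trans (same-query k) (trans hit (cong suc (h≗h′ n)))

module Application (X : Oracle) where
  open Search X
  open Embedding X

  embed-answer : ∀ a g n k z → embed a (query n g k) ≡ suc z → Σ[ y ∈ ℕ ] Ev X (decode a) (g 0) y × z ≡ embed y n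
  embed-answer a g n zero z answer = ⊥-elim (0≢1+n (trans (sym (embed-no-argument a n)) answer))
  embed-answer a g n (suc k) z answer with embed-argument a n (g 0) (seqCode (map g (applyUpTo suc k)))
  ... | inj₁ (_ , no-answer)      = ⊥-elim (0≢1+n (trans (sym no-answer) answer))
  ... | inj₂ (y , found , answer′) =
    y , search-sound (query n g (suc k)) a (g 0) y found , suc-injective (trans (sym answer) answer′)

  embed-eventually-answers : ∀ a g y → Ev X (decode a) (g 0) y → ∀ n →
                             Σ[ K ∈ ℕ ] Σ[ z ∈ ℕ ] embed a (query n g K) ≡ suc z
  embed-eventually-answers a g y ev n with search-complete a (g 0) y ev
  ... | D , finds with embed-argument a n (g 0) (seqCode (map g (applyUpTo suc D)))
  ...   | inj₁ (no-result , _)   = ⊥-elim (0≢1+n (trans (sym no-result) (finds _ (<-trans (n<1+n D) (k<query n g (suc D))))))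
  ...   | inj₂ (y′ , _ , answer) = suc D , embed y′ n , answer

  embed-app : ∀ a g y → Ev X (decode a) (g 0) y → App2 (embed a) g (embed y)
  embed-app a g y ev n =
    let K , z , answer          = embed-eventually-answers a g y ev n
        k , zeros , z′ , answer′ = first-nonzero (λ k → embed a (query n g k)) K z answer
        y′ , ev′ , z′≡          = embed-answer a g n k z′ answer′
    in k , zeros , trans answer′ (cong suc (trans z′≡ (cong (λ w → embed w n) (Ev-deterministic ev′ ev))))

  embed-app-inverse : ∀ a g h → App2 (embed a) g h → Σ[ y ∈ ℕ ] Ev X (decode a) (g 0) y × (∀ n → h n ≡ embed y n)
  embed-app-inverse a g h app =
    let k , _ , answer = app 0
        y , ev , _ = embed-answer a g 0 k (h 0) answer
    in y , ev , λ n → let k′ , _ , answer′ = app n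
                          y′ , ev′ , h≡ = embed-answer a g n k′ (h n) answer′
                      in trans h≡ (cong (λ w → embed w n) (Ev-deterministic ev′ ev))

module _ (𝒜 : PAS) where
  open PAS 𝒜 using (Carrier)

  _≋_ : Term Carrier → Term Carrier → Set
  u ≋ u′ = ∀ c → Eval 𝒜 u c ⇔ Eval 𝒜 u′ c

  ≋-app : ∀ u u′ x → u ≋ u′ → (u · el x) ≋ (u′ · el x)
  ≋-app _ _ x u≋u′ c = (λ (f , g , evalᵘ , evalˣ , app) → f , g , proj₁ (u≋u′ f) evalᵘ , evalˣ , app) ,
                   (λ (f , g , evalᵘ , evalˣ , app) → f , g , proj₂ (u≋u′ f) evalᵘ , evalˣ , app)

  Sim-resp-≋ : ∀ α u u′ v v′ → u ≋ u′ → v ≋ v′ → Sim 𝒜 α u v → Sim 𝒜 α u′ v′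
  Sim-resp-≋ ozero _ _ _ _ u≋u′ v≋v′ (u↓⇒v↓ , v↓⇒u↓ , u≈v) =
    (λ (c , evalᶜ) → let d , evalᵈ = u↓⇒v↓ (c , proj₂ (u≋u′ c) evalᶜ) in d , proj₁ (v≋v′ d) evalᵈ) ,
    (λ (c , evalᶜ) → let d , evalᵈ = v↓⇒u↓ (c , proj₂ (v≋v′ c) evalᶜ) in d , proj₁ (u≋u′ d) evalᵈ) ,
    λ c d evalᶜ evalᵈ → u≈v c d (proj₂ (u≋u′ c) evalᶜ) (proj₂ (v≋v′ d) evalᵈ)
  Sim-resp-≋ (osuc α) u u′ v v′ u≋u′ v≋v′ sim x =
    Sim-resp-≋ α (u · el x) (u′ · el x) (v · el x) (v′ · el x) (≋-app u u′ x u≋u′) (≋-app v v′ x v≋v′) (sim x)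
  Sim-resp-≋ (olim _ f) u u′ v v′ u≋u′ v≋v′ (i , sim) = i , Sim-resp-≋ (f i) u u′ v v′ u≋u′ v≋v′ sim

module Transfer (X : Oracle) where
  open Embedding X
  open Application X
  open Computable X

  𝒦 : PAS
  𝒦 = K1X X

  embedTerm : Term ℕ → Term Baire
  embedTerm = mapTerm embed

  from-embed-empty : ∀ {a b y} → Ev X (decode a) (embed b 0) y → Ev X (decode a) b y
  from-embed-empty {a} {b} {y} = subst (λ x → Ev X (decode a) x y) (embed-empty b)

  to-embed-empty : ∀ {a b y} → Ev X (decode a) b y → Ev X (decode a) (embed b 0) y
  to-embed-empty {a} {b} {y} = subst (λ x → Ev X (decode a) x y) (sym (embed-empty b))

  eval-embed : ∀ s c → Eval 𝒦 s c → Eval K2 (embedTerm s) (embed c)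
  eval-embed (el a)  c refl = λ _ → refl
  eval-embed (s · t) c (a , b , evalˢ , evalᵗ , ev) =
    embed a , embed b , eval-embed s a evalˢ , eval-embed t b evalᵗ , embed-app a (embed b) c (to-embed-empty {a} {b} ev)

  eval-embed⁻ : ∀ s h → Eval K2 (embedTerm s) h → Σ[ c ∈ ℕ ] Eval 𝒦 s c × (∀ n → embed c n ≡ h n)
  eval-embed⁻ (el a)  h a≈h = a , refl , a≈h
  eval-embed⁻ (s · t) h (f , g , evalˢ , evalᵗ , app)
    with eval-embed⁻ s f evalˢ | eval-embed⁻ t g evalᵗ
  ... | a , evalᵃ , a≈f | b , evalᵇ , b≈g
    with embed-app-inverse a (embed b) h (App2-cong (λ i → sym (a≈f i)) (λ i → sym (b≈g i)) (λ _ → refl) app)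
  ... | y , ev , h≈y = y , (a , b , evalᵃ , evalᵇ , from-embed-empty {a} {b} ev) , λ n → sym (h≈y n)

  defined-embed : ∀ s t → (Defined 𝒦 s → Defined 𝒦 t) → Defined K2 (embedTerm s) → Defined K2 (embedTerm t)
  defined-embed s t s↓⇒t↓ (h , evalʰ) =
    let c , evalᶜ , _ = eval-embed⁻ s h evalʰ
        d , evalᵈ     = s↓⇒t↓ (c , evalᶜ)
    in embed d , eval-embed t d evalᵈ

  defined-embed⁻ : ∀ s t → (Defined K2 (embedTerm s) → Defined K2 (embedTerm t)) → Defined 𝒦 s → Defined 𝒦 t
  defined-embed⁻ s t s↓⇒t↓ (c , evalᶜ) =
    let h , evalʰ     = s↓⇒t↓ (embed c , eval-embed s c evalᶜ)
        d , evalᵈ , _ = eval-embed⁻ t h evalʰ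
    in d , evalᵈ

  KEq-embed : ∀ s t → KEq 𝒦 s t → KEq K2 (embedTerm s) (embedTerm t)
  KEq-embed s t (s↓⇒t↓ , t↓⇒s↓ , s≡t) = defined-embed s t s↓⇒t↓ , defined-embed t s t↓⇒s↓ , same-value
    where
    same-value : ∀ h h′ → Eval K2 (embedTerm s) h → Eval K2 (embedTerm t) h′ → ∀ n → h n ≡ h′ n
    same-value h h′ evalʰ evalʰ′ n =
      let c , evalᶜ , c≈h  = eval-embed⁻ s h evalʰ
          d , evalᵈ , d≈h′ = eval-embed⁻ t h′ evalʰ′
      in trans (sym (c≈h n)) (trans (cong (λ z → embed z n) (s≡t c d evalᶜ evalᵈ)) (d≈h′ n))

  KEq-embed⁻ : ∀ s t → KEq K2 (embedTerm s) (embedTerm t) → KEq 𝒦 s t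
  KEq-embed⁻ s t (s↓⇒t↓ , t↓⇒s↓ , s≈t) = defined-embed⁻ s t s↓⇒t↓ , defined-embed⁻ t s t↓⇒s↓ , same-value
    where
    same-value : ∀ c d → Eval 𝒦 s c → Eval 𝒦 t d → c ≡ d
    same-value c d evalᶜ evalᵈ = begin
      c            ≡⟨ sym (embed-empty c) ⟩
      embed c 0    ≡⟨ s≈t (embed c) (embed d) (eval-embed s c evalᶜ) (eval-embed t d evalᵈ) 0 ⟩
      embed d 0    ≡⟨ embed-empty d ⟩
      d            ∎
      where open ≡-Reasoning

  app-depends-on-head : ∀ s x x′ → x 0 ≡ x′ 0 → ∀ h → Eval K2 (embedTerm s · el x) h → Eval K2 (embedTerm s · el x′) h
  app-depends-on-head s x x′ x₀≡x′₀ h (f , g , evalˢ , g≈x , app) =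
    let c , _ , c≈f = eval-embed⁻ s f evalˢ
        y , ev , h≈y = embed-app-inverse c x h (App2-cong (λ i → sym (c≈f i)) (λ i → sym (g≈x i)) (λ _ → refl) app)
    in f , x′ , evalˢ , (λ _ → refl) ,
       App2-cong c≈f (λ _ → refl) (λ i → sym (h≈y i))
                 (embed-app c x′ y (subst (λ z → Ev X (decode c) z y) x₀≡x′₀ ev))

  app-embedTerm-head : ∀ s x → _≋_ K2 (embedTerm s · el (embed (x 0))) (embedTerm s · el x)
  app-embedTerm-head s x h = app-depends-on-head s (embed (x 0)) x (embed-empty (x 0)) h ,
                             app-depends-on-head s x (embed (x 0)) (sym (embed-empty (x 0))) h

  Sim-embed : ∀ α s t → Sim 𝒦 α s t ⇔ Sim K2 α (embedTerm s) (embedTerm t)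
  Sim-embed ozero s t = KEq-embed s t , KEq-embed⁻ s t
  Sim-embed (osuc α) s t =
    (λ sim x → Sim-resp-≋ K2 α (embedTerm s · el (embed (x 0))) (embedTerm s · el x)
                                 (embedTerm t · el (embed (x 0))) (embedTerm t · el x)
                                 (app-embedTerm-head s x) (app-embedTerm-head t x)
                 (proj₁ (Sim-embed α (s · el (x 0)) (t · el (x 0))) (sim (x 0)))) ,
    (λ sim n → proj₂ (Sim-embed α (s · el n) (t · el n)) (sim (embed n)))
  Sim-embed (olim _ f) s t =
    (λ (i , sim) → i , proj₁ (Sim-embed (f i) s t) sim) ,
    (λ (i , sim) → i , proj₂ (Sim-embed (f i) s t) sim)

  embed-isEmbedding : IsEmbedding 𝒦 K2 embed
  embed-isEmbedding = record
    { injective  = λ a b a≈b → trans (sym (embed-empty a)) (trans (a≈b 0) (embed-empty b))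
    ; pres-def   = λ a b c ev → embed-app a (embed b) c (to-embed-empty {a} {b} ev)
    ; pres-undef = λ a b a·b↑ (h , app) →
                     let y , ev , _ = embed-app-inverse a (embed b) h app in a·b↑ (y , from-embed-empty {a} {b} ev)
    }

  embed-XComputable : XComputable X embed
  embed-XComputable = let e , ev = embedᶜ in
    e , λ n k → subst₂ (λ a b → Ev X e (pair n k) (embed a b)) (fst-pair n k) (snd-pair n k) (ev (pair n k))

  goodEmbedding : GoodEmbedding X
  goodEmbedding = embed , embed-isEmbedding , embed-XComputable , Sim-embed

theorem8p5 : ((X : Oracle) → GoodEmbedding X) × GoodEmbedding emptyOracle
theorem8p5 = Transfer.goodEmbedding , Transfer.goodEmbedding emptyOracle
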